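{- Let $m\subseteq\Sigma_1^*\times\Sigma_2^*$ be a string transduction. Then $m\in\mathrm{MSO}_n$ if and only if $m\in\mathrm{MSO}_e$ and $(\varepsilon,z)\in m$ implies $z=\varepsilon$.
   Context: Graphs $(V,E,\mathrm{lab})$, $E\subseteq V\times\Gamma\times V$ ($*$ = unlabelled), up to isomorphism; MSO logic with atomic formulas $\mathrm{lab}_\sigma(x)$, $\mathrm{edge}_\gamma(x,y)$, $x=y$, $x\in X$ and quantification over nodes and node sets. An mso definable graph transduction is given by a closed domain formula $\varphi_{dom}$, finite copy set $C$, node formulas $\varphi^c_\sigma(x)$ and edge formulas $\varphi^{c_1,c_2}_\gamma(x,y)$; on input $g\models\varphi_{dom}$ the output has nodes $(u,c)$ with exactly one $\sigma$ such that $g\models\varphi^c_\sigma(u)$ (labelled $\sigma$) and edges $((u,c_1),\gamma,(v,c_2))$ iff $g\models\varphi^{c_1,c_2}_\gamma(u,v)$; it is undefined on other graphs. For $w=a_1\cdots a_k$: $\mathrm{ngr}(w)$ has $k$ nodes labelled $a_1,\dots,a_k$ and unlabelled edges from the $i$-th to the $(i+1)$-th node ($\mathrm{ngr}(\varepsilon)$ empty); $\mathrm{egr}(w)$ has $k+1$ unlabelled nodes $v_0,\dots,v_k$ and edges $(v_{i-1},a_i,v_i)$. $\mathrm{MSO}_n$ (resp. $\mathrm{MSO}_e$) is the family of string transductions $m$ such that $\{(\mathrm{ngr}(w),\mathrm{ngr}(z)):(w,z)\in m\}$ (resp. $\{(\mathrm{egr}(w),\mathrm{egr}(z)):(w,z)\in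 m\}$) is an mso definable graph transduction. -}

module Defs where

open import Data.Bool using (Bool; true; false; _∧_; _∨_; not; if_then_else_)
open import Data.Nat using (ℕ; zero; suc; _≡ᵇ_)
open import Data.Fin using (Fin; toℕ) renaming (zero to fzero; suc to fsuc)
import Data.Fin as F
open import Data.Bool.ListAction using (any)
open import Data.List using (List; []; _∷_; length; lookup; allFin; concatMap; mapMaybe; filter)
open import Data.Vec using (Vec) renaming ([] to []ᵛ; _∷_ to _∷ᵛ_)
import Data.Vec as V
open import Data.Maybe using (Maybe; just; nothing)
open import Data.Product using (Σ; ∃; ∃-syntax; _×_; _,_; proj₁; proj₂)
open import Relation.Nullary.Decidable using (⌊_⌋)
open import Relation.Binary.PropositionalEquality using (_≡_)
open import Function.Bundles using (_↔_; Inverse)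

-- Finite graphs with node labels in Fin s and edge labels in Fin t.
-- Nodes are Fin n; the edge set E ⊆ V × Γ × V is given by its
-- characteristic (Boolean) function.  "Unlabelled" (*) = Fin 1.

record Graph (s t : ℕ) : Set where
  field
    size : ℕ
    lab  : Fin size → Fin s
    edge : Fin size → Fin t → Fin size → Bool
open Graph public

record _≅_ {s t : ℕ} (g h : Graph s t) : Set where
  field
    bij      : Fin (size g) ↔ Fin (size h)
    lab-pres : ∀ u → lab h (Inverse.to bij u) ≡ lab g u
    edge-pres : ∀ u γ v → edge h (Inverse.to bij u) γ (Inverse.to bij v) ≡ edge g u γ v

-- MSO formulas over graphs with labels Fin s / Fin t.
-- Formula s t i j : formulas with i free node variables and j free
-- node-set variables (de Bruijn indices).

data Formula (s t : ℕ) : ℕ → ℕ → Set where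
  labF  : ∀ {i j} → Fin s → Fin i → Formula s t i j
  edgeF : ∀ {i j} → Fin t → Fin i → Fin i → Formula s t i j
  eqF   : ∀ {i j} → Fin i → Fin i → Formula s t i j
  memF  : ∀ {i j} → Fin i → Fin j → Formula s t i j
  negF  : ∀ {i j} → Formula s t i j → Formula s t i j
  andF  : ∀ {i j} → Formula s t i j → Formula s t i j → Formula s t i j
  orF   : ∀ {i j} → Formula s t i j → Formula s t i j → Formula s t i j
  ex1   : ∀ {i j} → Formula s t (suc i) j → Formula s t i j
  all1  : ∀ {i j} → Formula s t (suc i) j → Formula s t i j
  ex2   : ∀ {i j} → Formula s t i (suc j) → Formula s t i j
  all2  : ∀ {i j} → Formula s t i (suc j) → Formula s t i j

allSubsets : (n : ℕ) → List (Vec Bool n)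
allSubsets zero    = []ᵛ ∷ []
allSubsets (suc n) = concatMap (λ v → (true ∷ᵛ v) ∷ (false ∷ᵛ v) ∷ []) (allSubsets n)

allL : ∀ {A : Set} → (A → Bool) → List A → Bool
allL p xs = not (any (λ x → not (p x)) xs)

eval : ∀ {s t i j} (g : Graph s t) → Formula s t i j →
       Vec (Fin (size g)) i → Vec (Vec Bool (size g)) j → Bool
eval g (labF σ x)    ρ η = ⌊ lab g (V.lookup ρ x) F.≟ σ ⌋
eval g (edgeF γ x y) ρ η = edge g (V.lookup ρ x) γ (V.lookup ρ y)
eval g (eqF x y)     ρ η = ⌊ V.lookup ρ x F.≟ V.lookup ρ y ⌋
eval g (memF x X)    ρ η = V.lookup (V.lookup η X) (V.lookup ρ x)
eval g (negF φ)      ρ η = not (eval g φ ρ η)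
eval g (andF φ ψ)    ρ η = eval g φ ρ η ∧ eval g ψ ρ η
eval g (orF φ ψ)     ρ η = eval g φ ρ η ∨ eval g ψ ρ η
eval g (ex1 φ)       ρ η = any  (λ u → eval g φ (u ∷ᵛ ρ) η) (allFin (size g))
eval g (all1 φ)      ρ η = allL (λ u → eval g φ (u ∷ᵛ ρ) η) (allFin (size g))
eval g (ex2 φ)       ρ η = any  (λ U → eval g φ ρ (U ∷ᵛ η)) (allSubsets (size g))
eval g (all2 φ)      ρ η = allL (λ U → eval g φ ρ (U ∷ᵛ η)) (allSubsets (size g))

record MSOT (s₁ t₁ s₂ t₂ : ℕ) : Set where
  field
    dom      : Formula s₁ t₁ 0 0
    copies   : ℕ
    nodeF    : Fin copies → Fin s₂ → Formula s₁ t₁ 1 0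
    edgeForm : Fin copies → Fin copies → Fin t₂ → Formula s₁ t₁ 2 0
open MSOT public

single : ∀ {A : Set} → List A → Maybe A
single (x ∷ []) = just x
single _        = nothing

module _ {s₁ t₁ s₂ t₂ : ℕ} (T : MSOT s₁ t₁ s₂ t₂) (g : Graph s₁ t₁) where

  nodeLabel : Fin (size g) → Fin (copies T) → Maybe (Fin s₂)
  nodeLabel u c = single (filter (λ σ → eval g (nodeF T c σ) (u ∷ᵛ []ᵛ) []ᵛ Data.Bool.≟ true) (allFin s₂))

  outNodes : List (Fin (size g) × Fin (copies T) × Fin s₂)
  outNodes = concatMap (λ u → mapMaybe (λ c → mk u c (nodeLabel u c)) (allFin (copies T))) (allFin (size g))
    where
      mk : Fin (size g) → Fin (copies T) → Maybe (Fin s₂) → Maybe (Fin (size g) × Fin (copies T) × Fin s₂)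
      mk u c (just σ) = just (u , c , σ)
      mk u c nothing  = nothing

  -- the output graph (meaningful when g ⊨ dom)
  output : Graph s₂ t₂
  output = record
    { size = length outNodes
    ; lab  = λ p → proj₂ (proj₂ (lookup outNodes p))
    ; edge = λ p γ q →
        eval g (edgeForm T (proj₁ (proj₂ (lookup outNodes p))) (proj₁ (proj₂ (lookup outNodes q))) γ)
               (proj₁ (lookup outNodes p) ∷ᵛ proj₁ (lookup outNodes q) ∷ᵛ []ᵛ) []ᵛ
    }

Defines : ∀ {s₁ t₁ s₂ t₂} → MSOT s₁ t₁ s₂ t₂ → (Graph s₁ t₁ → Graph s₂ t₂ → Set) → Set
Defines T R = ∀ g h → (R g h → (eval g (dom T) []ᵛ []ᵛ ≡ true) × (h ≅ output T g))
                    × ((eval g (dom T) []ᵛ []ᵛ ≡ true) × (h ≅ output T g) → R g h)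

ngr : ∀ {a} → List (Fin a) → Graph a 1
ngr w = record
  { size = length w
  ; lab  = lookup w
  ; edge = λ i _ j → toℕ j ≡ᵇ suc (toℕ i)
  }

-- egr: unlabelled (Fin 1) nodes v₀..v_k, edges (v_{i-1}, a_i, v_i)
egr : ∀ {a} → List (Fin a) → Graph 1 a
egr w = record
  { size = suc (length w)
  ; lab  = λ _ → fzero
  ; edge = λ i γ j → any (λ p → (toℕ i ≡ᵇ toℕ p) ∧ (toℕ j ≡ᵇ suc (toℕ p)) ∧ ⌊ lookup w p F.≟ γ ⌋)
                         (allFin (length w))
  }

Transduction : ℕ → ℕ → Set₁
Transduction a b = List (Fin a) → List (Fin b) → Set

ngrRel : ∀ {a b} → Transduction a b → Graph a 1 → Graph b 1 → Set
ngrRel m g h = ∃[ w ] ∃[ z ] (m w z × (g ≅ ngr w) × (h ≅ ngr z))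

egrRel : ∀ {a b} → Transduction a b → Graph 1 a → Graph 1 b → Set
egrRel m g h = ∃[ w ] ∃[ z ] (m w z × (g ≅ egr w) × (h ≅ egr z))

MSOn : ∀ {a b} → Transduction a b → Set
MSOn {a} {b} m = Σ (MSOT a 1 b 1) λ T → Defines T (ngrRel m)

MSOe : ∀ {a b} → Transduction a b → Set
MSOe {a} {b} m = Σ (MSOT 1 a 1 b) λ T → Defines T (egrRel m)

{-# OPTIONS --safe #-}
-- egr w is ngr w with an extra initial node and every label moved from a node to its incoming
-- edge, and both halves of this correspondence are MSO definable.
--
-- From MSO_e to MSO_n: a node-labelled graph g is read as its rooted graph (a fresh root with an
-- edge to the first node, labels on incoming edges), which is interpreted in g by letting every
-- variable range over "the root or a node of g".  Running the MSO_e transducer there, the output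
-- copies that sit on the root are moved to the first node of g, and every output node takes the
-- label of its incoming edge, so that the output root, the only node without one, disappears.
-- The first node exists unless the input is ε, which is why ε may only be mapped to ε.
--
-- From MSO_n to MSO_e: after checking in MSO that the input has the shape of a string graph (a
-- unique source, in-degree at most one), the MSO_n transducer runs on its node graph: the
-- non-root nodes, labelled by their incoming edge.  One extra copy on the input root becomes the
-- output root, with an edge to the first output node.  Finally an MSO_n transducer maps ε, whose
-- node graph is empty, to the empty graph, that is, to ε.
module Submission where

open import Defs
open import Axiom.UniquenessOfIdentityProofs using (module Decidable⇒UIP)
open import Data.Bool using (Bool; true; false; _∧_; _∨_; not; if_then_else_)
import Data.Bool as B
open import Data.Bool.ListAction using (any; or)
open import Data.Bool.Properties using (¬-not; ∨-assoc; ∨-identityʳ)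
open import Data.Empty using (⊥; ⊥-elim)
open import Data.Fin using (Fin; toℕ; inject₁; punchIn; punchOut) renaming (zero to fzero; suc to fsuc)
import Data.Fin as F
open import Data.Fin.Permutation using (lift₀; remove; insert; insert-punchIn)
import Data.Fin.Properties as FP
open import Data.List using (List; []; _∷_; _++_; length; lookup; allFin; concatMap; mapMaybe; catMaybes; filter; tabulate; map; concat)
import Data.List.Properties as LP
open import Data.Maybe using (Maybe; just; nothing; is-just)
import Data.Maybe as M
open import Data.Nat using (ℕ; zero; suc; _+_; _≡ᵇ_)
import Data.Nat.Properties as ℕ
open import Data.Product using (Σ; ∃; _×_; _,_; proj₁; proj₂)
open import Data.Product.Function.NonDependent.Propositional using (_×-↔_)
open import Data.Sum using (_⊎_; inj₁; inj₂; [_,_]; reduce)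
open import Data.Sum.Function.Propositional using (_⊎-↔_)
open import Data.Unit using (⊤; tt)
open import Data.Vec using (Vec) renaming ([] to []ᵛ; _∷_ to _∷ᵛ_)
import Data.Vec as V
import Data.Vec.Properties as VP
open import Function.Bundles using (_↔_; Inverse; Injection; mk↔ₛ′; _⇔_; mk⇔)
open import Function.Properties.Inverse using (↔-refl; ↔-sym; ↔-trans; ↔⇒↣)
open import Relation.Binary.PropositionalEquality hiding ([_])
open import Relation.Nullary using (¬_; yes; no; Dec)
open import Relation.Nullary.Decidable using (⌊_⌋; decidable-stable)

open Inverse using (to; from; strictlyInverseˡ; strictlyInverseʳ)

∨-introˡ : ∀ {a b} → a ≡ true → a ∨ b ≡ true
∨-introˡ refl = refl

∨-introʳ : ∀ {a b} → b ≡ true → a ∨ b ≡ true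
∨-introʳ {true}  _ = refl
∨-introʳ {false} e = e

∨-elim : ∀ {a b} {C : Set} → a ∨ b ≡ true → (a ≡ true → C) → (b ≡ true → C) → C
∨-elim {true}  _ f _ = f refl
∨-elim {false} e _ g = g e

∧-elimˡ : ∀ {a b} → a ∧ b ≡ true → a ≡ true
∧-elimˡ {true} _ = refl

∧-elimʳ : ∀ {a b} → a ∧ b ≡ true → b ≡ true
∧-elimʳ {true} e = e

∧-intro : ∀ {a b} → a ≡ true → b ≡ true → a ∧ b ≡ true
∧-intro refl refl = refl

not-≡true : ∀ {a} → not a ≡ true → a ≡ false
not-≡true {false} _ = refl

not-≡false : ∀ {a} → a ≡ false → not a ≡ true
not-≡false refl = refl

true≢false : ∀ {a} → a ≡ true → a ≡ false → ⊥
true≢false refl ()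

≡true-ext : ∀ {a b} → (a ≡ true → b ≡ true) → (b ≡ true → a ≡ true) → a ≡ b
≡true-ext {true}  {true}  _ _ = refl
≡true-ext {true}  {false} f _ = sym (f refl)
≡true-ext {false} {true}  _ g = g refl
≡true-ext {false} {false} _ _ = refl

bool-≡-irrelevant : ∀ {a b : Bool} (p q : a ≡ b) → p ≡ q
bool-≡-irrelevant = Decidable⇒UIP.≡-irrelevant B._≟_

≟-true : ∀ {n} {x y : Fin n} → x ≡ y → ⌊ x F.≟ y ⌋ ≡ true
≟-true {x = x} {y} e with x F.≟ y
... | yes _  = refl
... | no x≢y = ⊥-elim (x≢y e)

≟-false : ∀ {n} {x y : Fin n} → ¬ x ≡ y → ⌊ x F.≟ y ⌋ ≡ false
≟-false {x = x} {y} x≢y with x F.≟ y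
... | yes e = ⊥-elim (x≢y e)
... | no _  = refl

≟-sound : ∀ {n} {x y : Fin n} → ⌊ x F.≟ y ⌋ ≡ true → x ≡ y
≟-sound {x = x} {y} e with x F.≟ y
... | yes p = p

any-witness : ∀ {A : Set} {p : A → Bool} (xs : List A) → any p xs ≡ true → ∃ λ x → p x ≡ true
any-witness (x ∷ xs) e = ∨-elim e (λ px → x , px) (any-witness xs)

Complete : {A : Set} → List A → Set
Complete {A} xs = ∀ (p : A → Bool) x → p x ≡ true → any p xs ≡ true

any-++ : ∀ {A : Set} (p : A → Bool) xs ys → any p (xs ++ ys) ≡ any p xs ∨ any p ys
any-++ p []       ys = refl
any-++ p (x ∷ xs) ys = trans (cong (p x ∨_) (any-++ p xs ys)) (sym (∨-assoc (p x) _ _))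

any-concatMap : ∀ {A B : Set} (p : B → Bool) (h : A → List B) xs →
                any p (concatMap h xs) ≡ any (λ x → any p (h x)) xs
any-concatMap p h []       = refl
any-concatMap p h (x ∷ xs) = trans (any-++ p (h x) (concatMap h xs)) (cong (any p (h x) ∨_) (any-concatMap p h xs))

any-cong : ∀ {A : Set} {p q : A → Bool} → (∀ x → p x ≡ q x) → ∀ xs → any p xs ≡ any q xs
any-cong e xs = cong or (LP.map-cong e xs)

any-allFin-suc : ∀ {n} (p : Fin (suc n) → Bool) → any p (allFin (suc n)) ≡ p fzero ∨ any (λ c → p (fsuc c)) (allFin n)
any-allFin-suc p = cong (λ l → p fzero ∨ or l)
  (trans (LP.map-tabulate fsuc p) (sym (LP.map-tabulate (λ x → x) (λ c → p (fsuc c)))))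

allFin-complete : ∀ {n} → Complete (allFin n)
allFin-complete p fzero    h = ∨-introˡ h
allFin-complete {suc n} p (fsuc i) h =
  trans (any-allFin-suc p) (∨-introʳ (allFin-complete (λ c → p (fsuc c)) i h))

allSubsets-complete : ∀ {n} → Complete (allSubsets n)
allSubsets-complete p []ᵛ h = ∨-introˡ h
allSubsets-complete {suc n} p (b ∷ᵛ U) h =
  trans (any-concatMap p (λ v → (true ∷ᵛ v) ∷ (false ∷ᵛ v) ∷ []) (allSubsets n))
        (allSubsets-complete _ U (pair b h))
  where
    pair : ∀ b → p (b ∷ᵛ U) ≡ true → any p ((true ∷ᵛ U) ∷ (false ∷ᵛ U) ∷ []) ≡ true
    pair true  h = ∨-introˡ h
    pair false h = ∨-introʳ {p (true ∷ᵛ U)} (∨-introˡ h)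

any-↔ : ∀ {A B : Set} (xs : List A) (ys : List B) → Complete xs → Complete ys →
        (b : A ↔ B) (p : A → Bool) (q : B → Bool) → (∀ x → p x ≡ q (to b x)) → any p xs ≡ any q ys
any-↔ xs ys cx cy b p q e = ≡true-ext
  (λ h → let (x , px) = any-witness xs h in cy q (to b x) (trans (sym (e x)) px))
  (λ h → let (y , qy) = any-witness ys h in
         cx p (from b y) (trans (e (from b y)) (trans (cong q (strictlyInverseˡ b y)) qy)))

any-allFin-↔ : ∀ {n m} (b : Fin n ↔ Fin m) (p : Fin n → Bool) (q : Fin m → Bool) →
               (∀ x → p x ≡ q (to b x)) → any p (allFin n) ≡ any q (allFin m)
any-allFin-↔ {n} {m} = any-↔ (allFin n) (allFin m) allFin-complete allFin-complete

any-allSubsets-↔ : ∀ {n m} (b : Vec Bool n ↔ Vec Bool m) (p : Vec Bool n → Bool) (q : Vec Bool m → Bool) →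
                   (∀ x → p x ≡ q (to b x)) → any p (allSubsets n) ≡ any q (allSubsets m)
any-allSubsets-↔ {n} {m} = any-↔ (allSubsets n) (allSubsets m) allSubsets-complete allSubsets-complete

Fin1-irrelevant : (x y : Fin 1) → x ≡ y
Fin1-irrelevant fzero fzero = refl

to-injective : ∀ {A B : Set} (b : A ↔ B) {x y} → to b x ≡ to b y → x ≡ y
to-injective b = Injection.injective (↔⇒↣ b)

subsets-↔ : ∀ {n m} → Fin n ↔ Fin m → Vec Bool n ↔ Vec Bool m
subsets-↔ b = mk↔ₛ′
  (λ U → V.tabulate (λ y → V.lookup U (from b y)))
  (λ U → V.tabulate (λ x → V.lookup U (to b x)))
  (λ U → trans (VP.tabulate-cong (λ y → trans (VP.lookup∘tabulate _ (from b y)) (cong (V.lookup U) (strictlyInverseˡ b y))))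
               (VP.tabulate∘lookup U))
  (λ U → trans (VP.tabulate-cong (λ y → trans (VP.lookup∘tabulate _ (to b y)) (cong (V.lookup U) (strictlyInverseʳ b y))))
               (VP.tabulate∘lookup U))

-- Graphs up to isomorphism

record AbstractGraph (s t : ℕ) : Set₁ where
  field
    Node    : Set
    nodeLab : Node → Fin s
    edgeRel : Node → Fin t → Node → Bool
open AbstractGraph public

record _≃_ {s t : ℕ} (A B : AbstractGraph s t) : Set where
  field
    bij       : Node A ↔ Node B
    lab-pres  : ∀ u → nodeLab B (to bij u) ≡ nodeLab A u
    edge-pres : ∀ u γ v → edgeRel B (to bij u) γ (to bij v) ≡ edgeRel A u γ v
open _≃_ public

≃-refl : ∀ {s t} {A : AbstractGraph s t} → A ≃ A
≃-refl = record { bij = ↔-refl ; lab-pres = λ _ → refl ; edge-pres = λ _ _ _ → refl }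

≃-sym : ∀ {s t} {A B : AbstractGraph s t} → A ≃ B → B ≃ A
≃-sym {A = A} {B} i = record
  { bij       = ↔-sym (bij i)
  ; lab-pres  = λ u → trans (sym (lab-pres i (from (bij i) u))) (cong (nodeLab B) (strictlyInverseˡ (bij i) u))
  ; edge-pres = λ u γ v → trans (sym (edge-pres i (from (bij i) u) γ (from (bij i) v)))
                                (cong₂ (λ x y → edgeRel B x γ y) (strictlyInverseˡ (bij i) u) (strictlyInverseˡ (bij i) v))
  }

≃-trans : ∀ {s t} {A B C : AbstractGraph s t} → A ≃ B → B ≃ C → A ≃ C
≃-trans i j = record
  { bij       = ↔-trans (bij i) (bij j)
  ; lab-pres  = λ u → trans (lab-pres j _) (lab-pres i u)
  ; edge-pres = λ u γ v → trans (edge-pres j _ γ _) (edge-pres i u γ v)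
  }

abstractGraph : ∀ {s t} → Graph s t → AbstractGraph s t
abstractGraph g = record { Node = Fin (size g) ; nodeLab = lab g ; edgeRel = edge g }

≃⇒≅ : ∀ {s t} {g h : Graph s t} → abstractGraph g ≃ abstractGraph h → g ≅ h
≃⇒≅ i = record { bij = bij i ; lab-pres = lab-pres i ; edge-pres = edge-pres i }

≅⇒≃ : ∀ {s t} {g h : Graph s t} → g ≅ h → abstractGraph g ≃ abstractGraph h
≅⇒≃ i = record { bij = _≅_.bij i ; lab-pres = _≅_.lab-pres i ; edge-pres = _≅_.edge-pres i }

≅-refl : ∀ {s t} {g : Graph s t} → g ≅ g
≅-refl = ≃⇒≅ ≃-refl

≅-sym : ∀ {s t} {g h : Graph s t} → g ≅ h → h ≅ g
≅-sym i = ≃⇒≅ (≃-sym (≅⇒≃ i))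

≅-trans : ∀ {s t} {g h k : Graph s t} → g ≅ h → h ≅ k → g ≅ k
≅-trans i j = ≃⇒≅ (≃-trans (≅⇒≃ i) (≅⇒≃ j))

module _ {s t} {g h : Graph s t} (iso : g ≅ h) where
  private
    b = _≅_.bij iso

  eval-≅ : ∀ {i j} (φ : Formula s t i j) ρ η → eval g φ ρ η ≡ eval h φ (V.map (to b) ρ) (V.map (to (subsets-↔ b)) η)
  eval-≅ (labF σ x) ρ η rewrite VP.lookup-map x (to b) ρ | _≅_.lab-pres iso (V.lookup ρ x) = refl
  eval-≅ (edgeF γ x y) ρ η rewrite VP.lookup-map x (to b) ρ | VP.lookup-map y (to b) ρ = sym (_≅_.edge-pres iso _ γ _)
  eval-≅ (eqF x y) ρ η rewrite VP.lookup-map x (to b) ρ | VP.lookup-map y (to b) ρ with V.lookup ρ x F.≟ V.lookup ρ y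
  ... | yes e = sym (≟-true (cong (to b) e))
  ... | no ne = sym (≟-false (λ e → ne (to-injective b e)))
  eval-≅ (memF x X) ρ η rewrite VP.lookup-map x (to b) ρ | VP.lookup-map X (to (subsets-↔ b)) η
    | VP.lookup∘tabulate (λ y → V.lookup (V.lookup η X) (from b y)) (to b (V.lookup ρ x))
    | strictlyInverseʳ b (V.lookup ρ x) = refl
  eval-≅ (negF φ)   ρ η = cong not (eval-≅ φ ρ η)
  eval-≅ (andF φ ψ) ρ η = cong₂ _∧_ (eval-≅ φ ρ η) (eval-≅ ψ ρ η)
  eval-≅ (orF φ ψ)  ρ η = cong₂ _∨_ (eval-≅ φ ρ η) (eval-≅ ψ ρ η)
  eval-≅ (ex1 φ)  ρ η = any-allFin-↔ b _ _ (λ u → eval-≅ φ (u ∷ᵛ ρ) η)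
  eval-≅ (all1 φ) ρ η = cong not (any-allFin-↔ b _ _ (λ u → cong not (eval-≅ φ (u ∷ᵛ ρ) η)))
  eval-≅ (ex2 φ)  ρ η = any-allSubsets-↔ (subsets-↔ b) _ _ (λ U → eval-≅ φ ρ (U ∷ᵛ η))
  eval-≅ (all2 φ) ρ η = cong not (any-allSubsets-↔ (subsets-↔ b) _ _
                                    (λ U → cong not (eval-≅ φ ρ (U ∷ᵛ η))))

  sentence-≅ : (φ : Formula s t 0 0) → eval g φ []ᵛ []ᵛ ≡ eval h φ []ᵛ []ᵛ
  sentence-≅ φ = eval-≅ φ []ᵛ []ᵛ

-- The output graph of a transducer

filterTrue : ∀ {A : Set} → (A → Bool) → List A → List A
filterTrue p = filter (λ x → p x B.≟ true)

filterTrue-cong : ∀ {A : Set} {p q : A → Bool} → (∀ x → p x ≡ q x) → ∀ xs → filterTrue p xs ≡ filterTrue q xs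
filterTrue-cong e [] = refl
filterTrue-cong {p = p} {q} e (x ∷ xs) with p x | q x | e x
... | true  | .true  | refl = cong (x ∷_) (filterTrue-cong e xs)
... | false | .false | refl = filterTrue-cong e xs

module _ {A : Set} (p : A → Bool) where

  filterTrue-none : ∀ {s} (f : Fin s → A) → (∀ i → p (f i) ≡ false) → filterTrue p (tabulate f) ≡ []
  filterTrue-none {zero}  f h = refl
  filterTrue-none {suc s} f h with p (f fzero) | h fzero
  ... | false | _ = filterTrue-none (λ j → f (fsuc j)) (λ j → h (fsuc j))

  filterTrue-one : ∀ {s} (f : Fin s → A) i → p (f i) ≡ true → (∀ j → ¬ j ≡ i → p (f j) ≡ false) →
                   filterTrue p (tabulate f) ≡ f i ∷ []
  filterTrue-one {suc s} f fzero e h with p (f fzero) | e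
  ... | true | _ = cong (f fzero ∷_) (filterTrue-none (λ j → f (fsuc j)) (λ j → h (fsuc j) (λ ())))
  filterTrue-one {suc s} f (fsuc i) e h with p (f fzero) | h fzero (λ ())
  ... | false | _ = filterTrue-one (λ j → f (fsuc j)) i e (λ j j≢i → h (fsuc j) (λ eq → j≢i (FP.suc-injective eq)))

  filterTrue-nonempty : ∀ {s} (f : Fin s → A) i → p (f i) ≡ true → ¬ filterTrue p (tabulate f) ≡ []
  filterTrue-nonempty {suc s} f i e h with p (f fzero) in e0
  ... | true = case h
    where case : ∀ {y ys} → y ∷ ys ≡ [] → ⊥
          case ()
  filterTrue-nonempty {suc s} f fzero    e h | false = true≢false e e0
  filterTrue-nonempty {suc s} f (fsuc i) e h | false = filterTrue-nonempty (λ j → f (fsuc j)) i e h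

  single-filterTrue : ∀ {s} (f : Fin s → A) σ → single (filterTrue p (tabulate f)) ≡ just σ →
                      p σ ≡ true × (∀ j → p (f j) ≡ true → f j ≡ σ)
  single-filterTrue {suc s} f σ e with p (f fzero) in e0
  single-filterTrue {suc s} f σ e | true = first (filterTrue p (tabulate (λ j → f (fsuc j)))) refl e
    where
      first : ∀ r → filterTrue p (tabulate (λ j → f (fsuc j))) ≡ r → single (f fzero ∷ r) ≡ just σ →
              p σ ≡ true × (∀ j → p (f j) ≡ true → f j ≡ σ)
      first [] er refl = e0 , λ { fzero _ → refl ; (fsuc j) pj → ⊥-elim (filterTrue-nonempty (λ j → f (fsuc j)) j pj er) }
      first (_ ∷ _) er ()
  single-filterTrue {suc s} f σ e | false =
    let (pσ , rest) = single-filterTrue (λ j → f (fsuc j)) σ e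
    in pσ , λ { fzero pj → ⊥-elim (true≢false pj e0) ; (fsuc j) pj → rest j pj }

uniqueWitness : ∀ {s} → (Fin s → Bool) → Maybe (Fin s)
uniqueWitness {s} p = single (filterTrue p (allFin s))

uniqueWitness-cong : ∀ {s} {p q : Fin s → Bool} → (∀ x → p x ≡ q x) → uniqueWitness p ≡ uniqueWitness q
uniqueWitness-cong {s} e = cong single (filterTrue-cong e (allFin s))

uniqueWitness-sound : ∀ {s} (p : Fin s → Bool) σ → uniqueWitness p ≡ just σ →
                      p σ ≡ true × (∀ σ′ → p σ′ ≡ true → σ′ ≡ σ)
uniqueWitness-sound p = single-filterTrue p (λ x → x)

uniqueWitness-complete : ∀ {s} (p : Fin s → Bool) σ → p σ ≡ true → (∀ σ′ → p σ′ ≡ true → σ′ ≡ σ) →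
                         uniqueWitness p ≡ just σ
uniqueWitness-complete p σ e h = cong single (filterTrue-one p (λ x → x) σ e (λ j j≢σ → ¬-not (λ pj → j≢σ (h j pj))))

uniqueWitness-none : ∀ {s} (p : Fin s → Bool) → (∀ σ → p σ ≡ false) → uniqueWitness p ≡ nothing
uniqueWitness-none p h = cong single (filterTrue-none p (λ x → x) h)

is-just-uniqueWitness-Fin1 : (p : Fin 1 → Bool) → is-just (uniqueWitness p) ≡ p fzero
is-just-uniqueWitness-Fin1 p = by-value (p fzero) refl
  where
    by-value : ∀ b → p fzero ≡ b → is-just (uniqueWitness p) ≡ b
    by-value true  e = cong is-just (uniqueWitness-complete p fzero e (λ { fzero _ → refl }))
    by-value false e = cong is-just (uniqueWitness-none p (λ { fzero → e }))

fromJust : ∀ {Z : Set} (m : Maybe Z) → is-just m ≡ true → Z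
fromJust (just z) _ = z

fromJust-cong : ∀ {Z : Set} {m m′ : Maybe Z} → m ≡ m′ → ∀ pr pr′ → fromJust m pr ≡ fromJust m′ pr′
fromJust-cong {m = just _} refl _ _ = refl

just-fromJust : ∀ {A : Set} (m : Maybe A) pr → m ≡ just (fromJust m pr)
just-fromJust (just _) _ = refl

copy : ∀ {A K : Set} {P : A → K → Set} → Σ A (λ u → Σ K (P u)) → K
copy x = proj₁ (proj₂ x)

module _ {s₁ t₁ s₂ : ℕ} (g : Graph s₁ t₁) {K : Set} (nodeFs : K → Fin s₂ → Formula s₁ t₁ 1 0) where

  copyLabel : Fin (size g) → K → Maybe (Fin s₂)
  copyLabel u k = uniqueWitness (λ σ → eval g (nodeFs k σ) (u ∷ᵛ []ᵛ) []ᵛ)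

  OutNode : Set
  OutNode = Σ (Fin (size g)) λ u → Σ K λ k → is-just (copyLabel u k) ≡ true

outputOver : ∀ {s₁ t₁ s₂ t₂} (g : Graph s₁ t₁) {K : Set} →
             (K → Fin s₂ → Formula s₁ t₁ 1 0) → (K → K → Fin t₂ → Formula s₁ t₁ 2 0) → AbstractGraph s₂ t₂
outputOver g nodeFs edgeFs = record
  { Node    = OutNode g nodeFs
  ; nodeLab = λ x → fromJust (copyLabel g nodeFs (proj₁ x) (copy x)) (proj₂ (proj₂ x))
  ; edgeRel = λ x γ y → eval g (edgeFs (copy x) (copy y) γ) (proj₁ x ∷ᵛ proj₁ y ∷ᵛ []ᵛ) []ᵛ
  }

outputGraph : ∀ {s₁ t₁ s₂ t₂} → MSOT s₁ t₁ s₂ t₂ → Graph s₁ t₁ → AbstractGraph s₂ t₂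
outputGraph T g = outputOver g (nodeF T) (edgeForm T)

OutNode-≡ : ∀ {s₁ t₁ s₂} {g : Graph s₁ t₁} {K} {nodeFs : K → Fin s₂ → Formula s₁ t₁ 1 0} {u u′ k k′}
            {pr : is-just (copyLabel g nodeFs u k) ≡ true} {pr′ : is-just (copyLabel g nodeFs u′ k′) ≡ true} →
            u ≡ u′ → k ≡ k′ → _≡_ {A = OutNode g nodeFs} (u , k , pr) (u′ , k′ , pr′)
OutNode-≡ {pr = pr} {pr′} refl refl = cong (λ t → _ , _ , t) (bool-≡-irrelevant pr pr′)

Σ-≡true-↔ : ∀ {A A′ : Set} (b : A ↔ A′) (P : A → Bool) (Q : A′ → Bool) → (∀ a → P a ≡ Q (to b a)) →
            (Σ A λ a → P a ≡ true) ↔ (Σ A′ λ a → Q a ≡ true)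
Σ-≡true-↔ b P Q e = mk↔ₛ′
  (λ (a , pr) → to b a , trans (sym (e a)) pr)
  (λ (a′ , pr) → from b a′ , trans (e (from b a′)) (trans (cong Q (strictlyInverseˡ b a′)) pr))
  (λ (a′ , _) → Σ-≡true (strictlyInverseˡ b a′))
  (λ (a , _) → Σ-≡true (strictlyInverseʳ b a))
  where
    Σ-≡true : ∀ {X : Set} {R : X → Bool} {x y : X} {px : R x ≡ true} {py : R y ≡ true} →
              x ≡ y → _≡_ {A = Σ X λ x → R x ≡ true} (x , px) (y , py)
    Σ-≡true {px = px} {py} refl = cong (_ ,_) (bool-≡-irrelevant px py)

Σ₂-≡true-↔ : ∀ {A A′ C C′ : Set} (b : A ↔ A′) (d : C ↔ C′) (P : A → C → Bool) (Q : A′ → C′ → Bool) →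
             (∀ a c → P a c ≡ Q (to b a) (to d c)) →
             (Σ A λ a → Σ C λ c → P a c ≡ true) ↔ (Σ A′ λ a′ → Σ C′ λ c′ → Q a′ c′ ≡ true)
Σ₂-≡true-↔ b d P Q e =
  ↔-trans Σ-assoc (↔-trans (Σ-≡true-↔ (b ×-↔ d) (λ (a , c) → P a c) (λ (a , c) → Q a c) (λ (a , c) → e a c)) (↔-sym Σ-assoc))
  where
    Σ-assoc : ∀ {X Y : Set} {R : X → Y → Bool} → (Σ X λ x → Σ Y λ y → R x y ≡ true) ↔ (Σ (X × Y) λ (x , y) → R x y ≡ true)
    Σ-assoc = mk↔ₛ′ (λ (x , y , p) → (x , y) , p) (λ ((x , y) , p) → x , y , p) (λ _ → refl) (λ _ → refl)

module _ {s₁ t₁ s₂ t₂ : ℕ} {K K′ : Set} (g : Graph s₁ t₁) (b : K ↔ K′)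
         (nodeFs : K′ → Fin s₂ → Formula s₁ t₁ 1 0) (edgeFs : K′ → K′ → Fin t₂ → Formula s₁ t₁ 2 0) where

  outputOver-reindex : outputOver g (λ k → nodeFs (to b k)) (λ k k′ → edgeFs (to b k) (to b k′)) ≃ outputOver g nodeFs edgeFs
  outputOver-reindex = record
    { bij       = Σ₂-≡true-↔ ↔-refl b (λ u k → is-just (copyLabel g (λ k → nodeFs (to b k)) u k))
                                       (λ u k → is-just (copyLabel g nodeFs u k)) (λ _ _ → refl)
    ; lab-pres  = λ _ → refl
    ; edge-pres = λ _ _ _ → refl
    }

module _ {s₁ t₁ s₂ t₂ : ℕ} (T : MSOT s₁ t₁ s₂ t₂) {g g′ : Graph s₁ t₁} (iso : g ≅ g′) where
  private
    label-≡ : ∀ u c → copyLabel g (nodeF T) u c ≡ copyLabel g′ (nodeF T) (to (_≅_.bij iso) u) c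
    label-≡ u c = uniqueWitness-cong (λ σ → eval-≅ iso (nodeF T c σ) (u ∷ᵛ []ᵛ) []ᵛ)

  outputGraph-≅ : outputGraph T g ≃ outputGraph T g′
  outputGraph-≅ = record
    { bij       = Σ₂-≡true-↔ (_≅_.bij iso) ↔-refl _ _ (λ u c → cong is-just (label-≡ u c))
    ; lab-pres  = λ (u , c , _) → fromJust-cong (sym (label-≡ u c)) _ _
    ; edge-pres = λ (u , c , _) γ (v , d , _) → sym (eval-≅ iso (edgeForm T c d γ) (u ∷ᵛ v ∷ᵛ []ᵛ) []ᵛ)
    }

record Enumerates {Z I : Set} (xs : List Z) (ι : I → Z) : Set where
  field
    position        : Fin (length xs) ↔ I
    lookup-position : ∀ p → lookup xs p ≡ ι (to position p)
open Enumerates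

enumerates-transport : ∀ {Z I I′ : Set} {xs : List Z} {ι : I → Z} {ι′ : I′ → Z} →
                       Enumerates xs ι → (b : I ↔ I′) → (∀ i → ι i ≡ ι′ (to b i)) → Enumerates xs ι′
enumerates-transport E b e = record
  { position = ↔-trans (position E) b ; lookup-position = λ p → trans (lookup-position E p) (e _) }

enumerates-[] : ∀ {Z I : Set} {ι : I → Z} → ¬ I → Enumerates [] ι
enumerates-[] ¬i = record
  { position = mk↔ₛ′ (λ ()) (λ i → ⊥-elim (¬i i)) (λ i → ⊥-elim (¬i i)) (λ ()) ; lookup-position = λ () }

enumerates-∷ : ∀ {Z I : Set} {ι : I → Z} (z : Z) {xs : List Z} → Enumerates xs ι →
               Enumerates (z ∷ xs) [ (λ (_ : ⊤) → z) , ι ]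
enumerates-∷ z E = record
  { position = mk↔ₛ′ (λ { fzero → inj₁ tt ; (fsuc p) → inj₂ (to (position E) p) })
                     (λ { (inj₁ _) → fzero ; (inj₂ i) → fsuc (from (position E) i) })
                     (λ { (inj₁ tt) → refl ; (inj₂ i) → cong inj₂ (strictlyInverseˡ (position E) i) })
                     (λ { fzero → refl ; (fsuc p) → cong fsuc (strictlyInverseʳ (position E) p) })
  ; lookup-position = λ { fzero → refl ; (fsuc p) → lookup-position E p }
  }

module _ {Z : Set} where

  private
    split : (xs ys : List Z) → Fin (length (xs ++ ys)) → Fin (length xs) ⊎ Fin (length ys)
    split []       ys p        = inj₂ p
    split (x ∷ xs) ys fzero    = inj₁ fzero
    split (x ∷ xs) ys (fsuc p) = [ (λ i → inj₁ (fsuc i)) , inj₂ ] (split xs ys p)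

    join : (xs ys : List Z) → Fin (length xs) ⊎ Fin (length ys) → Fin (length (xs ++ ys))
    join []       ys (inj₂ q)        = q
    join (x ∷ xs) ys (inj₁ fzero)    = fzero
    join (x ∷ xs) ys (inj₁ (fsuc i)) = fsuc (join xs ys (inj₁ i))
    join (x ∷ xs) ys (inj₂ q)        = fsuc (join xs ys (inj₂ q))

    split-join : ∀ xs ys z → split xs ys (join xs ys z) ≡ z
    split-join []       ys (inj₂ q)        = refl
    split-join (x ∷ xs) ys (inj₁ fzero)    = refl
    split-join (x ∷ xs) ys (inj₁ (fsuc i)) rewrite split-join xs ys (inj₁ i) = refl
    split-join (x ∷ xs) ys (inj₂ q)        rewrite split-join xs ys (inj₂ q) = refl

    join-split : ∀ xs ys p → join xs ys (split xs ys p) ≡ p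
    join-split []       ys p     = refl
    join-split (x ∷ xs) ys fzero = refl
    join-split (x ∷ xs) ys (fsuc p) with split xs ys p | join-split xs ys p
    ... | inj₁ _ | e = cong fsuc e
    ... | inj₂ _ | e = cong fsuc e

    lookup-split : ∀ xs ys p → lookup (xs ++ ys) p ≡ [ lookup xs , lookup ys ] (split xs ys p)
    lookup-split []       ys p     = refl
    lookup-split (x ∷ xs) ys fzero = refl
    lookup-split (x ∷ xs) ys (fsuc p) with split xs ys p | lookup-split xs ys p
    ... | inj₁ _ | e = e
    ... | inj₂ _ | e = e

  enumerates-++ : ∀ {I J : Set} {xs ys : List Z} {ι : I → Z} {κ : J → Z} →
                  Enumerates xs ι → Enumerates ys κ → Enumerates (xs ++ ys) [ ι , κ ]
  enumerates-++ {xs = xs} {ys} {ι} {κ} E F = record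
    { position        = ↔-trans (mk↔ₛ′ (split xs ys) (join xs ys) (split-join xs ys) (join-split xs ys))
                                (position E ⊎-↔ position F)
    ; lookup-position = λ p → trans (lookup-split xs ys p) (on-parts (split xs ys p))
    }
    where
      on-parts : ∀ z → [ lookup xs , lookup ys ] z ≡ [ ι , κ ] (to (position E ⊎-↔ position F) z)
      on-parts (inj₁ i) = lookup-position E i
      on-parts (inj₂ j) = lookup-position F j

Σ-Fin-suc-↔ : ∀ {n} (P : Fin (suc n) → Set) → Σ (Fin (suc n)) P ↔ (P fzero ⊎ Σ (Fin n) (λ u → P (fsuc u)))
Σ-Fin-suc-↔ P = mk↔ₛ′
  (λ { (fzero , x) → inj₁ x ; (fsuc u , x) → inj₂ (u , x) })
  (λ { (inj₁ x) → fzero , x ; (inj₂ (u , x)) → fsuc u , x })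
  (λ { (inj₁ x) → refl ; (inj₂ (u , x)) → refl })
  (λ { (fzero , x) → refl ; (fsuc u , x) → refl })

enumerates-catMaybes : ∀ {Y Z : Set} k (e : Fin k → Y) (h : Y → Maybe Z) →
                       Enumerates (catMaybes (map h (tabulate e)))
                                  (λ (x : Σ (Fin k) λ c → is-just (h (e c)) ≡ true) → fromJust (h (e (proj₁ x))) (proj₂ x))
enumerates-catMaybes zero    e h = enumerates-[] (λ ())
enumerates-catMaybes (suc k) e h =
  enumerates-transport (head (h (e fzero)) (enumerates-catMaybes k (λ c → e (fsuc c)) h))
                       (↔-sym (Σ-Fin-suc-↔ (λ c → is-just (h (e c)) ≡ true)))
                       (λ { (inj₁ _) → refl ; (inj₂ _) → refl })
  where
    head : ∀ {Z I : Set} {ι : I → Z} (m : Maybe Z) {rest : List Z} → Enumerates rest ι →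
           Enumerates (M.maybe′ _∷_ (λ x → x) m rest) [ fromJust m , ι ]
    head (just z) E = enumerates-transport (enumerates-∷ z E)
      (mk↔ₛ′ [ (λ _ → inj₁ refl) , inj₂ ] [ (λ _ → inj₁ tt) , inj₂ ]
             (λ { (inj₁ refl) → refl ; (inj₂ _) → refl }) (λ { (inj₁ tt) → refl ; (inj₂ _) → refl }))
      (λ { (inj₁ tt) → refl ; (inj₂ _) → refl })
    head nothing E = enumerates-transport E
      (mk↔ₛ′ inj₂ [ (λ ()) , (λ i → i) ] (λ { (inj₁ ()) ; (inj₂ _) → refl }) (λ _ → refl))
      (λ _ → refl)

enumerates-concat : ∀ {X Z : Set} n (e : Fin n → X) (F : X → List Z) (J : Fin n → Set) (κ : (u : Fin n) → J u → Z) →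
                    (∀ u → Enumerates (F (e u)) (κ u)) →
                    Enumerates (concat (map F (tabulate e))) (λ (x : Σ (Fin n) J) → κ (proj₁ x) (proj₂ x))
enumerates-concat zero    e F J κ E = enumerates-[] (λ ())
enumerates-concat (suc n) e F J κ E =
  enumerates-transport
    (enumerates-++ (E fzero) (enumerates-concat n (λ u → e (fsuc u)) F (λ u → J (fsuc u)) (λ u → κ (fsuc u)) (λ u → E (fsuc u))))
    (↔-sym (Σ-Fin-suc-↔ J))
    (λ { (inj₁ _) → refl ; (inj₂ _) → refl })

module _ {s₁ t₁ s₂ t₂ : ℕ} (T : MSOT s₁ t₁ s₂ t₂) (g : Graph s₁ t₁) where
  private
    -- outNodes uses a where-bound helper that cannot be named; recover it by unification.
    helper : Σ (Fin (size g) → Fin (copies T) → Maybe (Fin (size g) × Fin (copies T) × Fin s₂))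
               (λ H → outNodes T g ≡ concatMap (λ u → mapMaybe (H u) (allFin (copies T))) (allFin (size g)))
    helper = _ , refl

    mk : Fin (size g) → Fin (copies T) → Maybe (Fin (size g) × Fin (copies T) × Fin s₂)
    mk = proj₁ helper

    is-just-mk : ∀ u c → is-just (mk u c) ≡ is-just (nodeLabel T g u c)
    is-just-mk u c with nodeLabel T g u c
    ... | just _  = refl
    ... | nothing = refl

    fromJust-mk : ∀ u c pr pr′ → fromJust (mk u c) pr ≡ (u , c , fromJust (nodeLabel T g u c) pr′)
    fromJust-mk u c pr pr′ with nodeLabel T g u c
    ... | just _ = refl

    outNodes-enumerates : Enumerates (outNodes T g) (λ (x : OutNode g (nodeF T)) → (proj₁ x , copy x , nodeLab (outputGraph T g) x))
    outNodes-enumerates = enumerates-transport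
      (enumerates-concat (size g) (λ u → u) (λ u → mapMaybe (mk u) (allFin (copies T)))
         (λ u → Σ (Fin (copies T)) (λ c → is-just (mk u c) ≡ true))
         (λ u (c , pr) → fromJust (mk u c) pr)
         (λ u → enumerates-catMaybes (copies T) (λ c → c) (mk u)))
      (Σ₂-≡true-↔ ↔-refl ↔-refl _ _ (λ u c → is-just-mk u c))
      (λ (u , c , pr) → fromJust-mk u c pr (trans (sym (is-just-mk u c)) pr))

  output≃outputGraph : abstractGraph (output T g) ≃ outputGraph T g
  output≃outputGraph = record
    { bij       = position outNodes-enumerates
    ; lab-pres  = λ p → sym (cong (λ x → proj₂ (proj₂ x)) (lookup-position outNodes-enumerates p))
    ; edge-pres = λ p γ q → sym (cong₂ (λ x y → eval g (edgeForm T (proj₁ (proj₂ x)) (proj₁ (proj₂ y)) γ)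
                                                      (proj₁ x ∷ᵛ proj₁ y ∷ᵛ []ᵛ) []ᵛ)
                                       (lookup-position outNodes-enumerates p) (lookup-position outNodes-enumerates q))
    }

output-≅ : ∀ {s₁ t₁ s₂ t₂} (T : MSOT s₁ t₁ s₂ t₂) {g g′ : Graph s₁ t₁} → g ≅ g′ → output T g ≅ output T g′
output-≅ T {g} {g′} iso =
  ≃⇒≅ (≃-trans (output≃outputGraph T g) (≃-trans (outputGraph-≅ T iso) (≃-sym (output≃outputGraph T g′))))

⊤F : ∀ {s t i j} → Formula s t i j
⊤F = all1 (eqF fzero fzero)

⊥F : ∀ {s t i j} → Formula s t i j
⊥F = negF ⊤F

eval-⊤F : ∀ {s t i j} (g : Graph s t) ρ η → eval g (⊤F {i = i} {j}) ρ η ≡ true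
eval-⊤F g ρ η = cong not (trans (any-cong (λ u → cong not (≟-true {x = u} refl)) (allFin (size g))) (any-false (allFin (size g))))
  where
    any-false : ∀ {A : Set} (xs : List A) → any (λ _ → false) xs ≡ false
    any-false []       = refl
    any-false (_ ∷ xs) = any-false xs

eval-⊥F : ∀ {s t i j} (g : Graph s t) ρ η → eval g (⊥F {i = i} {j}) ρ η ≡ false
eval-⊥F g ρ η = cong not (eval-⊤F g ρ η)

bigOr : ∀ {s t i j} k → (Fin k → Formula s t i j) → Formula s t i j
bigOr zero    F = ⊥F
bigOr (suc k) F = orF (F fzero) (bigOr k (λ c → F (fsuc c)))

eval-bigOr : ∀ {s t i j} (g : Graph s t) k (F : Fin k → Formula s t i j) ρ η →
             eval g (bigOr k F) ρ η ≡ any (λ c → eval g (F c) ρ η) (allFin k)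
eval-bigOr g zero    F ρ η = eval-⊥F g ρ η
eval-bigOr g (suc k) F ρ η = trans (cong (eval g (F fzero) ρ η ∨_) (eval-bigOr g k (λ c → F (fsuc c)) ρ η))
                                   (sym (any-allFin-suc (λ c → eval g (F c) ρ η)))

bigAnd : ∀ {s t i j} k → (Fin k → Formula s t i j) → Formula s t i j
bigAnd zero    F = ⊤F
bigAnd (suc k) F = andF (F fzero) (bigAnd k (λ c → F (fsuc c)))

eval-bigAnd⁻ : ∀ {s t i j} (g : Graph s t) k (F : Fin k → Formula s t i j) ρ η →
               eval g (bigAnd k F) ρ η ≡ true → ∀ c → eval g (F c) ρ η ≡ true
eval-bigAnd⁻ g (suc k) F ρ η e fzero    = ∧-elimˡ e
eval-bigAnd⁻ g (suc k) F ρ η e (fsuc c) = eval-bigAnd⁻ g k (λ c → F (fsuc c)) ρ η (∧-elimʳ {eval g (F fzero) ρ η} e) c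

eval-bigAnd⁺ : ∀ {s t i j} (g : Graph s t) k (F : Fin k → Formula s t i j) ρ η →
               (∀ c → eval g (F c) ρ η ≡ true) → eval g (bigAnd k F) ρ η ≡ true
eval-bigAnd⁺ g zero    F ρ η h = eval-⊤F g ρ η
eval-bigAnd⁺ g (suc k) F ρ η h = ∧-intro (h fzero) (eval-bigAnd⁺ g k (λ c → F (fsuc c)) ρ η (λ c → h (fsuc c)))

allL-allFin⁻ : ∀ {n} (p : Fin n → Bool) → allL p (allFin n) ≡ true → ∀ u → p u ≡ true
allL-allFin⁻ p e u with p u in pu
... | true  = refl
... | false = ⊥-elim (true≢false (allFin-complete (λ u → not (p u)) u (cong not pu)) (not-≡true e))

allL-allFin⁺ : ∀ {n} (p : Fin n → Bool) → (∀ u → p u ≡ true) → allL p (allFin n) ≡ true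
allL-allFin⁺ {n} p h = not-≡false (¬-not (λ e → let (u , pu) = any-witness (allFin n) e in true≢false (h u) (not-≡true pu)))

exactlyOne : ∀ {s t i j} b → (Fin b → Formula s t i j) → Formula s t i j
exactlyOne b F = bigOr b (λ σ → andF (F σ) (bigAnd b (λ σ′ → if ⌊ σ′ F.≟ σ ⌋ then ⊤F else negF (F σ′))))

eval-exactlyOne : ∀ {s t i j} (g : Graph s t) b (F : Fin b → Formula s t i j) ρ η →
                  eval g (exactlyOne b F) ρ η ≡ is-just (uniqueWitness (λ σ → eval g (F σ) ρ η))
eval-exactlyOne g b F ρ η = trans (eval-bigOr g b _ ρ η) (≡true-ext
  (λ e → let (σ , h) = any-witness (allFin b) e
             unique : ∀ σ′ → eval g (F σ′) ρ η ≡ true → σ′ ≡ σ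
             unique σ′ hσ′ = only-σ σ′ hσ′ (eval-bigAnd⁻ g b _ ρ η (∧-elimʳ {eval g (F σ) ρ η} h) σ′)
         in cong is-just (uniqueWitness-complete _ σ (∧-elimˡ h) unique))
  (λ e → let (σ , eσ) = is-just⇒just e
             (pσ , unique) = uniqueWitness-sound _ σ eσ
         in allFin-complete _ σ (∧-intro pσ (eval-bigAnd⁺ g b _ ρ η (λ σ′ → others-fail σ′ (unique σ′))))))
  where
    is-just⇒just : ∀ {A : Set} {m : Maybe A} → is-just m ≡ true → Σ A λ x → m ≡ just x
    is-just⇒just {m = just x} _ = x , refl
    only-σ : ∀ {σ} σ′ → eval g (F σ′) ρ η ≡ true →
             eval g (if ⌊ σ′ F.≟ σ ⌋ then ⊤F else negF (F σ′)) ρ η ≡ true → σ′ ≡ σ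
    only-σ {σ} σ′ h1 h2 with σ′ F.≟ σ
    ... | yes e = e
    ... | no _  = ⊥-elim (true≢false h1 (not-≡true h2))
    others-fail : ∀ {σ} σ′ → (eval g (F σ′) ρ η ≡ true → σ′ ≡ σ) →
                  eval g (if ⌊ σ′ F.≟ σ ⌋ then ⊤F else negF (F σ′)) ρ η ≡ true
    others-fail {σ} σ′ u with σ′ F.≟ σ
    ... | yes _ = eval-⊤F g ρ η
    ... | no ne = not-≡false (¬-not (λ h → ne (u h)))

extend : ∀ {i i′} → (Fin i → Fin i′) → Fin (suc i) → Fin (suc i′)
extend f fzero    = fzero
extend f (fsuc x) = fsuc (f x)

rename : ∀ {s t i i′ j} → (Fin i → Fin i′) → Formula s t i j → Formula s t i′ j
rename f (labF σ x)    = labF σ (f x)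
rename f (edgeF γ x y) = edgeF γ (f x) (f y)
rename f (eqF x y)     = eqF (f x) (f y)
rename f (memF x X)    = memF (f x) X
rename f (negF φ)      = negF (rename f φ)
rename f (andF φ ψ)    = andF (rename f φ) (rename f ψ)
rename f (orF φ ψ)     = orF (rename f φ) (rename f ψ)
rename f (ex1 φ)       = ex1 (rename (extend f) φ)
rename f (all1 φ)      = all1 (rename (extend f) φ)
rename f (ex2 φ)       = ex2 (rename f φ)
rename f (all2 φ)      = all2 (rename f φ)

eval-rename : ∀ {s t i i′ j} (g : Graph s t) (f : Fin i → Fin i′) (φ : Formula s t i j) ρ ρ₀ η →
              (∀ x → V.lookup ρ₀ x ≡ V.lookup ρ (f x)) → eval g (rename f φ) ρ η ≡ eval g φ ρ₀ η
eval-rename g f (labF σ x)    ρ ρ₀ η h rewrite h x = refl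
eval-rename g f (edgeF γ x y) ρ ρ₀ η h rewrite h x | h y = refl
eval-rename g f (eqF x y)     ρ ρ₀ η h rewrite h x | h y = refl
eval-rename g f (memF x X)    ρ ρ₀ η h rewrite h x = refl
eval-rename g f (negF φ)      ρ ρ₀ η h = cong not (eval-rename g f φ ρ ρ₀ η h)
eval-rename g f (andF φ ψ)    ρ ρ₀ η h = cong₂ _∧_ (eval-rename g f φ ρ ρ₀ η h) (eval-rename g f ψ ρ ρ₀ η h)
eval-rename g f (orF φ ψ)     ρ ρ₀ η h = cong₂ _∨_ (eval-rename g f φ ρ ρ₀ η h) (eval-rename g f ψ ρ ρ₀ η h)
eval-rename g f (ex1 φ)  ρ ρ₀ η h =
  any-cong (λ u → eval-rename g (extend f) φ (u ∷ᵛ ρ) (u ∷ᵛ ρ₀) η (λ { fzero → refl ; (fsuc x) → h x })) (allFin (size g))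
eval-rename g f (all1 φ) ρ ρ₀ η h =
  cong not (any-cong (λ u → cong not (eval-rename g (extend f) φ (u ∷ᵛ ρ) (u ∷ᵛ ρ₀) η (λ { fzero → refl ; (fsuc x) → h x })))
                     (allFin (size g)))
eval-rename g f (ex2 φ)  ρ ρ₀ η h = any-cong (λ U → eval-rename g f φ ρ ρ₀ (U ∷ᵛ η) h) (allSubsets (size g))
eval-rename g f (all2 φ) ρ ρ₀ η h = cong not (any-cong (λ U → cong not (eval-rename g f φ ρ ρ₀ (U ∷ᵛ η) h)) (allSubsets (size g)))

toℕ≢0⇒predecessor : ∀ {L} (x : Fin L) → ¬ toℕ x ≡ 0 → Σ (Fin L) λ y → toℕ x ≡ suc (toℕ y)
toℕ≢0⇒predecessor fzero    x≢0 = ⊥-elim (x≢0 refl)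
toℕ≢0⇒predecessor (fsuc y) _   = inject₁ y , cong suc (sym (FP.toℕ-inject₁ y))

≡ᵇ⇒≡ : ∀ {m n} → (m ≡ᵇ n) ≡ true → m ≡ n
≡ᵇ⇒≡ {m} {n} e = ℕ.≡ᵇ⇒≡ m n (subst B.T (sym e) tt)

≡⇒≡ᵇ : ∀ {m n} → m ≡ n → (m ≡ᵇ n) ≡ true
≡⇒≡ᵇ {m} {n} e with m ≡ᵇ n | ℕ.≡⇒≡ᵇ m n e
... | true | _ = refl

module _ {a : ℕ} (w : List (Fin a)) where

  ngr-edge⁻ : ∀ i γ j → edge (ngr w) i γ j ≡ true → toℕ j ≡ suc (toℕ i)
  ngr-edge⁻ i γ j = ≡ᵇ⇒≡

  ngr-edge⁺ : ∀ i γ j → toℕ j ≡ suc (toℕ i) → edge (ngr w) i γ j ≡ true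
  ngr-edge⁺ i γ j = ≡⇒≡ᵇ

  egr-edge⁺ : ∀ i γ j (p : Fin (length w)) → toℕ i ≡ toℕ p → toℕ j ≡ suc (toℕ p) → lookup w p ≡ γ →
              edge (egr w) i γ j ≡ true
  egr-edge⁺ i γ j p e₁ e₂ e₃ = allFin-complete _ p (∧-intro (≡⇒≡ᵇ e₁) (∧-intro (≡⇒≡ᵇ e₂) (≟-true e₃)))

  egr-edge⁻ : ∀ i γ j → edge (egr w) i γ j ≡ true →
              Σ (Fin (length w)) λ p → (toℕ i ≡ toℕ p) × (toℕ j ≡ suc (toℕ p)) × (lookup w p ≡ γ)
  egr-edge⁻ i γ j e =
    let (p , h) = any-witness (allFin (length w)) e
        h′ = ∧-elimʳ {toℕ i ≡ᵇ toℕ p} h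
    in p , ≡ᵇ⇒≡ (∧-elimˡ h) , ≡ᵇ⇒≡ (∧-elimˡ h′) , ≟-sound (∧-elimʳ {toℕ j ≡ᵇ suc (toℕ p)} h′)

  egr-edge-inject₁ : ∀ j → edge (egr w) (inject₁ j) (lookup w j) (fsuc j) ≡ true
  egr-edge-inject₁ j = egr-edge⁺ (inject₁ j) (lookup w j) (fsuc j) j (FP.toℕ-inject₁ j) refl refl

  egr-no-edge-into-0 : ∀ i γ → edge (egr w) i γ fzero ≡ false
  egr-no-edge-into-0 i γ = ¬-not (λ e → let (_ , _ , 0≡1+p , _) = egr-edge⁻ i γ fzero e in ℕ.0≢1+n 0≡1+p)

  egr-edge-into-suc : ∀ i γ j → edge (egr w) i γ (fsuc j) ≡ true → (i ≡ inject₁ j) × (γ ≡ lookup w j)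
  egr-edge-into-suc i γ j e =
    let (p , e₁ , e₂ , e₃) = egr-edge⁻ i γ (fsuc j) e
        p≡j = FP.toℕ-injective (sym (ℕ.suc-injective e₂))
    in FP.toℕ-injective (trans e₁ (trans (cong toℕ p≡j) (sym (FP.toℕ-inject₁ j)))) , trans (sym e₃) (cong (lookup w) p≡j)

  egr-edge-target : ∀ i σ x → edge (egr w) i σ x ≡ true → Σ (Fin (length w)) λ j → (x ≡ fsuc j) × (σ ≡ lookup w j)
  egr-edge-target i σ fzero    e = ⊥-elim (true≢false e (egr-no-edge-into-0 i σ))
  egr-edge-target i σ (fsuc j) e = j , refl , proj₂ (egr-edge-into-suc i σ j e)

  egr-edge-suc⁻ : ∀ σ i j → edge (egr w) (fsuc i) σ (fsuc j) ≡ true → (toℕ j ≡ suc (toℕ i)) × (σ ≡ lookup w j)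
  egr-edge-suc⁻ σ i j e =
    let (e₁ , e₂) = egr-edge-into-suc (fsuc i) σ j e in trans (sym (FP.toℕ-inject₁ j)) (cong toℕ (sym e₁)) , e₂

  egr-edge-suc⁺ : ∀ σ i j → toℕ j ≡ suc (toℕ i) → σ ≡ lookup w j → edge (egr w) (fsuc i) σ (fsuc j) ≡ true
  egr-edge-suc⁺ σ i j e₁ e₂ = egr-edge⁺ (fsuc i) σ (fsuc j) j (sym e₁) refl (sym e₂)

  egr-edge-0⁻ : ∀ σ j → edge (egr w) fzero σ (fsuc j) ≡ true → (toℕ j ≡ 0) × (σ ≡ lookup w j)
  egr-edge-0⁻ σ j e =
    let (e₁ , e₂) = egr-edge-into-suc fzero σ j e in trans (sym (FP.toℕ-inject₁ j)) (cong toℕ (sym e₁)) , e₂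

  egr-edge-0⁺ : ∀ σ j → toℕ j ≡ 0 → σ ≡ lookup w j → edge (egr w) fzero σ (fsuc j) ≡ true
  egr-edge-0⁺ σ j e₁ e₂ = egr-edge⁺ fzero σ (fsuc j) j (sym e₁) refl (sym e₂)

  any-egr-edge : ∀ i j → any (λ σ → edge (egr w) (fsuc i) σ (fsuc j)) (allFin a) ≡ edge (ngr w) i fzero j
  any-egr-edge i j = ≡true-ext
    (λ e → let (σ , h) = any-witness (allFin a) e in ngr-edge⁺ i fzero j (proj₁ (egr-edge-suc⁻ σ i j h)))
    (λ e → allFin-complete _ (lookup w j) (egr-edge-suc⁺ (lookup w j) i j (ngr-edge⁻ i fzero j e) refl))

-- The rooted graph of a node-labelled graph

any-allSubsets-suc : ∀ {n} (p : Vec Bool (suc n) → Bool) →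
                     any p (allSubsets (suc n)) ≡ any (λ U → p (true ∷ᵛ U) ∨ p (false ∷ᵛ U)) (allSubsets n)
any-allSubsets-suc {n} p =
  trans (any-concatMap p (λ v → (true ∷ᵛ v) ∷ (false ∷ᵛ v) ∷ []) (allSubsets n))
        (any-cong (λ U → cong (p (true ∷ᵛ U) ∨_) (∨-identityʳ _)) (allSubsets n))

module Rooted {a : ℕ} where

  isFirst : (g : Graph a 1) → Fin (size g) → Bool
  isFirst g v = not (any (λ u → edge g u fzero v) (allFin (size g)))

  rootedEdge : (g : Graph a 1) → Fin (suc (size g)) → Fin a → Fin (suc (size g)) → Bool
  rootedEdge g fzero    γ fzero    = false
  rootedEdge g fzero    γ (fsuc v) = isFirst g v ∧ ⌊ lab g v F.≟ γ ⌋
  rootedEdge g (fsuc u) γ fzero    = false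
  rootedEdge g (fsuc u) γ (fsuc v) = edge g u fzero v ∧ ⌊ lab g v F.≟ γ ⌋

  rooted : Graph a 1 → Graph 1 a
  rooted g = record { size = suc (size g) ; lab = λ _ → fzero ; edge = rootedEdge g }

  locate : ∀ {n i′} → Vec (Fin n) i′ → Maybe (Fin i′) → Fin (suc n)
  locate ρ nothing  = fzero
  locate ρ (just y) = fsuc (V.lookup ρ y)

  edgeᵘ : ∀ {i′ j} → Fin a → Maybe (Fin i′) → Maybe (Fin i′) → Formula a 1 i′ j
  edgeᵘ γ nothing  nothing  = ⊥F
  edgeᵘ γ nothing  (just y) = andF (negF (ex1 (edgeF fzero fzero (fsuc y)))) (labF γ y)
  edgeᵘ γ (just x) nothing  = ⊥F
  edgeᵘ γ (just x) (just y) = andF (edgeF fzero x y) (labF γ y)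

  eqᵘ : ∀ {i′ j} → Maybe (Fin i′) → Maybe (Fin i′) → Formula a 1 i′ j
  eqᵘ nothing  nothing  = ⊤F
  eqᵘ nothing  (just y) = ⊥F
  eqᵘ (just x) nothing  = ⊥F
  eqᵘ (just x) (just y) = eqF x y

  memᵘ : ∀ {i′ j} → Vec Bool j → Fin j → Maybe (Fin i′) → Formula a 1 i′ j
  memᵘ bs X nothing  = if V.lookup bs X then ⊤F else ⊥F
  memᵘ bs X (just x) = memF x X

  atRoot : ∀ {i i′} → (Fin i → Maybe (Fin i′)) → Fin (suc i) → Maybe (Fin i′)
  atRoot env fzero    = nothing
  atRoot env (fsuc x) = env x

  atNode : ∀ {i i′} → (Fin i → Maybe (Fin i′)) → Fin (suc i) → Maybe (Fin (suc i′))
  atNode env fzero    = just fzero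
  atNode env (fsuc x) = M.map fsuc (env x)

  -- A node variable of a formula over  rooted g  becomes  nothing  (the root) or a node
  -- variable over g; bs records whether the root belongs to each set variable.
  unroot : ∀ {i i′ j} → (Fin i → Maybe (Fin i′)) → Vec Bool j → Formula 1 a i j → Formula a 1 i′ j
  unroot env bs (labF σ x)    = ⊤F
  unroot env bs (edgeF γ x y) = edgeᵘ γ (env x) (env y)
  unroot env bs (eqF x y)     = eqᵘ (env x) (env y)
  unroot env bs (memF x X)    = memᵘ bs X (env x)
  unroot env bs (negF φ)      = negF (unroot env bs φ)
  unroot env bs (andF φ ψ)    = andF (unroot env bs φ) (unroot env bs ψ)
  unroot env bs (orF φ ψ)     = orF (unroot env bs φ) (unroot env bs ψ)
  unroot env bs (ex1 φ)       = orF (unroot (atRoot env) bs φ) (ex1 (unroot (atNode env) bs φ))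
  unroot env bs (all1 φ)      = negF (orF (negF (unroot (atRoot env) bs φ)) (ex1 (negF (unroot (atNode env) bs φ))))
  unroot env bs (ex2 φ)       = ex2 (orF (unroot env (true ∷ᵛ bs) φ) (unroot env (false ∷ᵛ bs) φ))
  unroot env bs (all2 φ)      = negF (ex2 (orF (negF (unroot env (true ∷ᵛ bs) φ)) (negF (unroot env (false ∷ᵛ bs) φ))))

  module _ (g : Graph a 1) where
    private
      n = size g

    eval-edgeᵘ : ∀ {i′ j} γ (mx my : Maybe (Fin i′)) (ρ : Vec (Fin n) i′) (η : Vec (Vec Bool n) j) →
                 eval g (edgeᵘ γ mx my) ρ η ≡ rootedEdge g (locate ρ mx) γ (locate ρ my)
    eval-edgeᵘ γ nothing  nothing  ρ η = eval-⊥F g ρ η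
    eval-edgeᵘ γ nothing  (just y) ρ η = refl
    eval-edgeᵘ γ (just x) nothing  ρ η = eval-⊥F g ρ η
    eval-edgeᵘ γ (just x) (just y) ρ η = refl

    eval-eqᵘ : ∀ {i′ j} (mx my : Maybe (Fin i′)) (ρ : Vec (Fin n) i′) (η : Vec (Vec Bool n) j) →
               eval g (eqᵘ mx my) ρ η ≡ ⌊ locate ρ mx F.≟ locate ρ my ⌋
    eval-eqᵘ nothing  nothing  ρ η = eval-⊤F g ρ η
    eval-eqᵘ nothing  (just y) ρ η = trans (eval-⊥F g ρ η) (sym (≟-false {x = fzero} {fsuc (V.lookup ρ y)} (λ ())))
    eval-eqᵘ (just x) nothing  ρ η = trans (eval-⊥F g ρ η) (sym (≟-false {x = fsuc (V.lookup ρ x)} {fzero} (λ ())))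
    eval-eqᵘ (just x) (just y) ρ η = ≡true-ext (λ e → ≟-true (cong fsuc (≟-sound e))) (λ e → ≟-true (FP.suc-injective (≟-sound e)))

    eval-memᵘ : ∀ {i′ j} (bs : Vec Bool j) X (mx : Maybe (Fin i′)) (ρ : Vec (Fin n) i′) (η : Vec (Vec Bool n) j) →
                eval g (memᵘ bs X mx) ρ η ≡ V.lookup (V.lookup bs X ∷ᵛ V.lookup η X) (locate ρ mx)
    eval-memᵘ bs X nothing ρ η with V.lookup bs X
    ... | true  = eval-⊤F g ρ η
    ... | false = eval-⊥F g ρ η
    eval-memᵘ bs X (just x) ρ η = refl

    Located : ∀ {i i′} → (Fin i → Maybe (Fin i′)) → Vec (Fin n) i′ → Vec (Fin (suc n)) i → Set
    Located env ρ ρ* = ∀ x → V.lookup ρ* x ≡ locate ρ (env x)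

    located-atRoot : ∀ {i i′} {env : Fin i → Maybe (Fin i′)} {ρ ρ*} → Located env ρ ρ* → Located (atRoot env) ρ (fzero ∷ᵛ ρ*)
    located-atRoot h fzero    = refl
    located-atRoot h (fsuc x) = h x

    located-atNode : ∀ {i i′} {env : Fin i → Maybe (Fin i′)} {ρ ρ*} → Located env ρ ρ* →
                     ∀ u → Located (atNode env) (u ∷ᵛ ρ) (fsuc u ∷ᵛ ρ*)
    located-atNode h u fzero = refl
    located-atNode {env = env} h u (fsuc x) with env x | h x
    ... | nothing | e = e
    ... | just _  | e = e

    SetsLocated : ∀ {j} → Vec Bool j → Vec (Vec Bool n) j → Vec (Vec Bool (suc n)) j → Set
    SetsLocated bs η η* = ∀ X → V.lookup η* X ≡ V.lookup bs X ∷ᵛ V.lookup η X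

    sets-located-∷ : ∀ {j} {bs : Vec Bool j} {η η*} → SetsLocated bs η η* →
                     ∀ b U → SetsLocated (b ∷ᵛ bs) (U ∷ᵛ η) ((b ∷ᵛ U) ∷ᵛ η*)
    sets-located-∷ h b U fzero    = refl
    sets-located-∷ h b U (fsuc X) = h X

    eval-unroot : ∀ {i i′ j} env (bs : Vec Bool j) (φ : Formula 1 a i j) (ρ : Vec (Fin n) i′) (η : Vec (Vec Bool n) j) ρ* η* →
                  Located env ρ ρ* → SetsLocated bs η η* → eval g (unroot env bs φ) ρ η ≡ eval (rooted g) φ ρ* η*
    eval-unroot env bs (labF fzero x) ρ η ρ* η* hρ hη = eval-⊤F g ρ η
    eval-unroot env bs (edgeF γ x y)  ρ η ρ* η* hρ hη rewrite hρ x | hρ y = eval-edgeᵘ γ (env x) (env y) ρ η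
    eval-unroot env bs (eqF x y)      ρ η ρ* η* hρ hη rewrite hρ x | hρ y = eval-eqᵘ (env x) (env y) ρ η
    eval-unroot env bs (memF x X)     ρ η ρ* η* hρ hη rewrite hρ x | hη X = eval-memᵘ bs X (env x) ρ η
    eval-unroot env bs (negF φ)   ρ η ρ* η* hρ hη = cong not (eval-unroot env bs φ ρ η ρ* η* hρ hη)
    eval-unroot env bs (andF φ ψ) ρ η ρ* η* hρ hη =
      cong₂ _∧_ (eval-unroot env bs φ ρ η ρ* η* hρ hη) (eval-unroot env bs ψ ρ η ρ* η* hρ hη)
    eval-unroot env bs (orF φ ψ)  ρ η ρ* η* hρ hη =
      cong₂ _∨_ (eval-unroot env bs φ ρ η ρ* η* hρ hη) (eval-unroot env bs ψ ρ η ρ* η* hρ hη)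
    eval-unroot env bs (ex1 φ) ρ η ρ* η* hρ hη =
      trans (cong₂ _∨_ (eval-unroot (atRoot env) bs φ ρ η _ η* (located-atRoot hρ) hη)
                       (any-cong (λ u → eval-unroot (atNode env) bs φ (u ∷ᵛ ρ) η _ η* (located-atNode hρ u) hη) (allFin n)))
            (sym (any-allFin-suc (λ u → eval (rooted g) φ (u ∷ᵛ ρ*) η*)))
    eval-unroot env bs (all1 φ) ρ η ρ* η* hρ hη =
      cong not (trans (cong₂ _∨_ (cong not (eval-unroot (atRoot env) bs φ ρ η _ η* (located-atRoot hρ) hη))
                                 (any-cong (λ u → cong not (eval-unroot (atNode env) bs φ (u ∷ᵛ ρ) η _ η* (located-atNode hρ u) hη)) (allFin n)))
                      (sym (any-allFin-suc (λ u → not (eval (rooted g) φ (u ∷ᵛ ρ*) η*)))))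
    eval-unroot env bs (ex2 φ) ρ η ρ* η* hρ hη =
      trans (any-cong (λ U → cong₂ _∨_ (eval-unroot env (true ∷ᵛ bs) φ ρ (U ∷ᵛ η) ρ* _ hρ (sets-located-∷ hη true U))
                                       (eval-unroot env (false ∷ᵛ bs) φ ρ (U ∷ᵛ η) ρ* _ hρ (sets-located-∷ hη false U)))
                      (allSubsets n))
            (sym (any-allSubsets-suc (λ U → eval (rooted g) φ ρ* (U ∷ᵛ η*))))
    eval-unroot env bs (all2 φ) ρ η ρ* η* hρ hη =
      cong not (trans (any-cong (λ U → cong₂ _∨_ (cong not (eval-unroot env (true ∷ᵛ bs) φ ρ (U ∷ᵛ η) ρ* _ hρ (sets-located-∷ hη true U)))
                                                 (cong not (eval-unroot env (false ∷ᵛ bs) φ ρ (U ∷ᵛ η) ρ* _ hρ (sets-located-∷ hη false U))))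
                                (allSubsets n))
                      (sym (any-allSubsets-suc (λ U → not (eval (rooted g) φ ρ* (U ∷ᵛ η*))))))

  rooted-≅ : ∀ {g g′ : Graph a 1} → g ≅ g′ → rooted g ≅ rooted g′
  rooted-≅ {g} {g′} i = record { bij = lift₀ b ; lab-pres = λ _ → refl ; edge-pres = edges }
    where
      b = _≅_.bij i
      first-≡ : ∀ v → isFirst g′ (to b v) ≡ isFirst g v
      first-≡ v = cong not (sym (any-allFin-↔ b _ _ (λ u → sym (_≅_.edge-pres i u fzero v))))
      label-≡ : ∀ v γ → ⌊ lab g′ (to b v) F.≟ γ ⌋ ≡ ⌊ lab g v F.≟ γ ⌋
      label-≡ v γ = cong (λ l → ⌊ l F.≟ γ ⌋) (_≅_.lab-pres i v)
      edges : ∀ u γ v → rootedEdge g′ (to (lift₀ b) u) γ (to (lift₀ b) v) ≡ rootedEdge g u γ v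
      edges fzero    γ fzero    = refl
      edges fzero    γ (fsuc v) = cong₂ _∧_ (first-≡ v) (label-≡ v γ)
      edges (fsuc u) γ fzero    = refl
      edges (fsuc u) γ (fsuc v) = cong₂ _∧_ (_≅_.edge-pres i u fzero v) (label-≡ v γ)

  rooted-ngr : (w : List (Fin a)) → rooted (ngr w) ≅ egr w
  rooted-ngr w = record { bij = ↔-refl ; lab-pres = λ { fzero → refl ; (fsuc _) → refl } ; edge-pres = edges }
    where
      first-node : ∀ γ v → edge (egr w) fzero γ (fsuc v) ≡ rootedEdge (ngr w) fzero γ (fsuc v)
      first-node γ v = ≡true-ext
        (λ e → let (v≡0 , γ≡) = egr-edge-0⁻ w γ v e in
               ∧-intro (not-≡false (¬-not (λ h → let (u , hu) = any-witness (allFin (length w)) h in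
                                                 ℕ.0≢1+n (trans (sym v≡0) (ngr-edge⁻ w u fzero v hu)))))
                       (≟-true (sym γ≡)))
        (λ e → egr-edge-0⁺ w γ v (first⇒0 v (∧-elimˡ e)) (sym (≟-sound (∧-elimʳ {isFirst (ngr w) v} e))))
        where
          first⇒0 : ∀ v → isFirst (ngr w) v ≡ true → toℕ v ≡ 0
          first⇒0 v e = decidable-stable (toℕ v ℕ.≟ 0) λ v≢0 →
            let (u , v≡1+u) = toℕ≢0⇒predecessor v v≢0
            in true≢false (allFin-complete _ u (ngr-edge⁺ w u fzero v v≡1+u)) (not-≡true e)
      edges : ∀ u γ v → edge (egr w) u γ v ≡ rootedEdge (ngr w) u γ v
      edges fzero    γ fzero    = egr-no-edge-into-0 w fzero γ
      edges (fsuc u) γ fzero    = egr-no-edge-into-0 w (fsuc u) γ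
      edges fzero    γ (fsuc v) = first-node γ v
      edges (fsuc u) γ (fsuc v) = ≡true-ext
        (λ e → let (e₁ , e₂) = egr-edge-suc⁻ w γ u v e in ∧-intro (ngr-edge⁺ w u fzero v e₁) (≟-true (sym e₂)))
        (λ e → egr-edge-suc⁺ w γ u v (ngr-edge⁻ w u fzero v (∧-elimˡ e)) (sym (≟-sound (∧-elimʳ {edge (ngr w) u fzero v} e))))

  ≅-ngr⇒rooted-≅-egr : ∀ {g : Graph a 1} {w} → g ≅ ngr w → rooted g ≅ egr w
  ≅-ngr⇒rooted-≅-egr {w = w} i = ≅-trans (rooted-≅ i) (rooted-ngr w)

  rooted-edge-into : (g : Graph a 1) (u : Fin (size g)) → ∃ λ src → rootedEdge g src (lab g u) (fsuc u) ≡ true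
  rooted-edge-into g u with any (λ u′ → edge g u′ fzero u) (allFin (size g)) in e
  ... | true  = let (u′ , h) = any-witness (allFin (size g)) e in fsuc u′ , ∧-intro h (≟-true refl)
  ... | false = fzero , ∧-intro (not-≡false e) (≟-true refl)

  rooted-no-edge-into-root : (g : Graph a 1) → ∀ src γ → rootedEdge g src γ fzero ≡ false
  rooted-no-edge-into-root g fzero    γ = refl
  rooted-no-edge-into-root g (fsuc u) γ = refl

  -- The isomorphism must fix the root, the only node without incoming edges on both sides.
  rooted-≅-egr⇒≅-ngr : ∀ {g : Graph a 1} {w} → rooted g ≅ egr w → g ≅ ngr w
  rooted-≅-egr⇒≅-ngr {g} {w} i = record { bij = b′ ; lab-pres = labels ; edge-pres = edges }
    where
      b = _≅_.bij i
      egr-edge-via : ∀ {x y γ} → rootedEdge g x γ y ≡ true → edge (egr w) (to b x) γ (to b y) ≡ true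
      egr-edge-via {x} {y} {γ} h = trans (_≅_.edge-pres i x γ y) h
      root↦root : to b fzero ≡ fzero
      root↦root with to b fzero in e
      ... | fzero  = refl
      ... | fsuc j = ⊥-elim (true≢false
              (trans (sym (_≅_.edge-pres i (from b (inject₁ j)) (lookup w j) fzero))
                     (trans (cong₂ (λ p q → edge (egr w) p (lookup w j) q) (strictlyInverseˡ b (inject₁ j)) e) (egr-edge-inject₁ w j)))
              (rooted-no-edge-into-root g (from b (inject₁ j)) (lookup w j)))
      b′ = remove fzero b
      b-suc : ∀ u → to b (fsuc u) ≡ fsuc (to b′ u)
      b-suc u = sym (trans (cong (λ r → punchIn r (to b′ u)) (sym root↦root)) (FP.punchIn-punchOut _))
      labels : ∀ u → lookup w (to b′ u) ≡ lab g u
      labels u = let (src , h) = rooted-edge-into g u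
                     into-u = subst (λ q → edge (egr w) (to b src) (lab g u) q ≡ true) (b-suc u) (egr-edge-via h)
                 in sym (proj₂ (egr-edge-into-suc w (to b src) (lab g u) (to b′ u) into-u))
      edges : ∀ u γ v → edge (ngr w) (to b′ u) γ (to b′ v) ≡ edge g u γ v
      edges u fzero v = ≡true-ext
        (λ e → let h : edge (egr w) (fsuc (to b′ u)) (lab g v) (fsuc (to b′ v)) ≡ true
                   h = egr-edge-suc⁺ w (lab g v) (to b′ u) (to b′ v) (ngr-edge⁻ w (to b′ u) fzero (to b′ v) e) (sym (labels v))
               in ∧-elimˡ (trans (sym (_≅_.edge-pres i (fsuc u) (lab g v) (fsuc v)))
                                 (trans (cong₂ (λ p q → edge (egr w) p (lab g v) q) (b-suc u) (b-suc v)) h)))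
        (λ e → let h = subst₂ (λ p q → edge (egr w) p (lab g v) q ≡ true) (b-suc u) (b-suc v)
                              (egr-edge-via {fsuc u} {fsuc v} (∧-intro e (≟-true refl)))
               in ngr-edge⁺ w (to b′ u) fzero (to b′ v) (proj₁ (egr-edge-suc⁻ w (lab g v) (to b′ u) (to b′ v) h)))

  module _ {g : Graph a 1} {w : List (Fin a)} (i : g ≅ ngr w) where
    private
      b = _≅_.bij i

    isFirst⇒0 : ∀ u → isFirst g u ≡ true → toℕ (to b u) ≡ 0
    isFirst⇒0 u e = decidable-stable (toℕ (to b u) ℕ.≟ 0) λ u≢0 →
      let (y , u≡1+y) = toℕ≢0⇒predecessor (to b u) u≢0
          u′ = from b y
          into-u : edge g u′ fzero u ≡ true
          into-u = trans (sym (_≅_.edge-pres i u′ fzero u))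
                         (ngr-edge⁺ w (to b u′) fzero (to b u) (trans u≡1+y (cong (λ t → suc (toℕ t)) (sym (strictlyInverseˡ b y)))))
      in true≢false (allFin-complete (λ x → edge g x fzero u) u′ into-u) (not-≡true e)

    0⇒isFirst : ∀ u → toℕ (to b u) ≡ 0 → isFirst g u ≡ true
    0⇒isFirst u u≡0 = not-≡false (¬-not λ h →
      let (u′ , hu) = any-witness (allFin (size g)) h
      in ℕ.0≢1+n (trans (sym u≡0) (ngr-edge⁻ w (to b u′) fzero (to b u) (trans (_≅_.edge-pres i u′ fzero u) hu))))

    isFirst-unique : ∀ u u′ → isFirst g u ≡ true → isFirst g u′ ≡ true → u ≡ u′
    isFirst-unique u u′ f f′ = to-injective b (FP.toℕ-injective (trans (isFirst⇒0 u f) (sym (isFirst⇒0 u′ f′))))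

    first-exists : Fin (length w) → Σ (Fin (size g)) λ u → isFirst g u ≡ true
    first-exists j = from b (zero-of j) , 0⇒isFirst _ (trans (cong toℕ (strictlyInverseˡ b (zero-of j))) (toℕ-zero-of j))
      where
        zero-of : ∀ {L} → Fin L → Fin L
        zero-of fzero    = fzero
        zero-of (fsuc _) = fzero
        toℕ-zero-of : ∀ {L} (j : Fin L) → toℕ (zero-of j) ≡ 0
        toℕ-zero-of fzero    = refl
        toℕ-zero-of (fsuc _) = refl

nonempty-source : ∀ {A B : Set} (w : List A) (z : List B) → (w ≡ [] → z ≡ []) → Fin (length z) → Fin (length w)
nonempty-source []      z h j with () ← subst (λ z → Fin (length z)) (h refl) j
nonempty-source (_ ∷ _) z h j = fzero

-- From MSO_e to MSO_n

module NodeTransducer {a b : ℕ} (Te : MSOT 1 a 1 b) where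
  open Rooted {a}

  private
    k = copies Te

  -- Edge graphs have a single node label, so copy c of a node exists iff this formula holds.
  present : Fin k → Formula 1 a 1 0
  present c = nodeF Te c fzero

  incoming : Fin k → Fin b → Formula 1 a 1 0
  incoming c σ = ex1 (bigOr k (λ d → andF (rename (λ _ → fzero) (present d)) (edgeForm Te d c σ)))

  labelledBy : Fin k → Fin b → Formula 1 a 1 0
  labelledBy c σ = andF (present c) (incoming c σ)

  anyEdge : Fin k → Fin k → Formula 1 a 2 0
  anyEdge c d = bigOr b (edgeForm Te c d)

  -- Copies inj₁ c sit on the non-root nodes of  rooted g,  copies inj₂ c on the root,
  -- which is represented by the first node of g.
  Copy : Set
  Copy = Fin k ⊎ Fin k

  placed : ∀ {i} → Copy → Fin i → Maybe (Fin i)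
  placed (inj₁ _) x = just x
  placed (inj₂ _) x = nothing

  placedPair : Copy → Copy → Fin 2 → Maybe (Fin 2)
  placedPair s s′ fzero    = placed s fzero
  placedPair s s′ (fsuc _) = placed s′ (fsuc fzero)

  first : Formula a 1 1 0
  first = negF (ex1 (edgeF fzero fzero (fsuc fzero)))

  nodeFs : Copy → Fin b → Formula a 1 1 0
  nodeFs (inj₁ c) σ = unroot (λ _ → just fzero) []ᵛ (labelledBy c σ)
  nodeFs (inj₂ c) σ = andF first (unroot (λ _ → nothing) []ᵛ (labelledBy c σ))

  edgeFs : Copy → Copy → Fin 1 → Formula a 1 2 0
  edgeFs s s′ _ = unroot (placedPair s s′) []ᵛ (anyEdge (reduce s) (reduce s′))

  nodeT : MSOT a 1 b 1
  nodeT = record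
    { dom      = unroot (λ ()) []ᵛ (dom Te)
    ; copies   = k + k
    ; nodeF    = λ c → nodeFs (F.splitAt k c)
    ; edgeForm = λ c d → edgeFs (F.splitAt k c) (F.splitAt k d)
    }

  module Semantics (g : Graph a 1) where
    private
      n = size g

    presentAt : Fin (suc n) → Fin k → Bool
    presentAt u* c = eval (rooted g) (present c) (u* ∷ᵛ []ᵛ) []ᵛ

    incomingAt : Fin (suc n) → Fin k → Fin b → Bool
    incomingAt u* c σ = any (λ v* → any (λ d → presentAt v* d ∧ eval (rooted g) (edgeForm Te d c σ) (v* ∷ᵛ u* ∷ᵛ []ᵛ) []ᵛ)
                                        (allFin k))
                            (allFin (suc n))

    eval-node : ∀ u* c σ → eval (rooted g) (labelledBy c σ) (u* ∷ᵛ []ᵛ) []ᵛ ≡ presentAt u* c ∧ incomingAt u* c σ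
    eval-node u* c σ = cong (presentAt u* c ∧_) (any-cong (λ v* →
      trans (eval-bigOr (rooted g) k _ (v* ∷ᵛ u* ∷ᵛ []ᵛ) []ᵛ)
            (any-cong (λ d → cong (_∧ eval (rooted g) (edgeForm Te d c σ) (v* ∷ᵛ u* ∷ᵛ []ᵛ) []ᵛ)
                                  (eval-rename (rooted g) (λ _ → fzero) (present d) (v* ∷ᵛ u* ∷ᵛ []ᵛ) (v* ∷ᵛ []ᵛ) []ᵛ
                                               (λ { fzero → refl })))
                      (allFin k))) (allFin (suc n)))

    eval-node-inj₁ : ∀ u c σ → eval g (nodeFs (inj₁ c) σ) (u ∷ᵛ []ᵛ) []ᵛ ≡ presentAt (fsuc u) c ∧ incomingAt (fsuc u) c σ
    eval-node-inj₁ u c σ =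
      trans (eval-unroot g (λ _ → just fzero) []ᵛ (labelledBy c σ) (u ∷ᵛ []ᵛ) []ᵛ (fsuc u ∷ᵛ []ᵛ) []ᵛ (λ { fzero → refl }) (λ ()))
            (eval-node (fsuc u) c σ)

    eval-node-inj₂ : ∀ u c σ → eval g (nodeFs (inj₂ c) σ) (u ∷ᵛ []ᵛ) []ᵛ ≡ isFirst g u ∧ (presentAt fzero c ∧ incomingAt fzero c σ)
    eval-node-inj₂ u c σ = cong (isFirst g u ∧_)
      (trans (eval-unroot g (λ _ → nothing) []ᵛ (labelledBy c σ) (u ∷ᵛ []ᵛ) []ᵛ (fzero ∷ᵛ []ᵛ) []ᵛ (λ { fzero → refl }) (λ ()))
             (eval-node fzero c σ))

    place : Copy → Fin n → Fin (suc n)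
    place (inj₁ _) u = fsuc u
    place (inj₂ _) u = fzero

    eval-edge : ∀ s s′ γ u v → eval g (edgeFs s s′ γ) (u ∷ᵛ v ∷ᵛ []ᵛ) []ᵛ ≡
                any (λ σ → eval (rooted g) (edgeForm Te (reduce s) (reduce s′) σ) (place s u ∷ᵛ place s′ v ∷ᵛ []ᵛ) []ᵛ) (allFin b)
    eval-edge s s′ γ u v =
      trans (eval-unroot g (placedPair s s′) []ᵛ (anyEdge (reduce s) (reduce s′)) (u ∷ᵛ v ∷ᵛ []ᵛ) []ᵛ
                         (place s u ∷ᵛ place s′ v ∷ᵛ []ᵛ) []ᵛ (located s s′) (λ ()))
            (eval-bigOr (rooted g) b _ _ []ᵛ)
      where
        located : ∀ s s′ → Located g (placedPair s s′) (u ∷ᵛ v ∷ᵛ []ᵛ) (place s u ∷ᵛ place s′ v ∷ᵛ []ᵛ)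
        located (inj₁ _) s′        fzero        = refl
        located (inj₂ _) s′        fzero        = refl
        located s        (inj₁ _) (fsuc fzero) = refl
        located s        (inj₂ _) (fsuc fzero) = refl

    eval-dom : eval g (dom nodeT) []ᵛ []ᵛ ≡ eval (rooted g) (dom Te) []ᵛ []ᵛ
    eval-dom = eval-unroot g (λ ()) []ᵛ (dom Te) []ᵛ []ᵛ []ᵛ []ᵛ (λ ()) (λ ())

  module Output (g : Graph a 1) {w : List (Fin a)} (isoN : g ≅ ngr w) {z : List (Fin b)}
                (isoE : outputGraph Te (rooted g) ≃ abstractGraph (egr z)) (hz : w ≡ [] → z ≡ []) where
    open Semantics g

    private
      n = size g
      β = to (bij isoE)
      Eout = OutNode (rooted g) (nodeF Te)
      Nout = OutNode g nodeFs

    present-defined : ∀ u* c → is-just (copyLabel (rooted g) (nodeF Te) u* c) ≡ presentAt u* c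
    present-defined u* c = is-just-uniqueWitness-Fin1 (λ σ → eval (rooted g) (nodeF Te c σ) (u* ∷ᵛ []ᵛ) []ᵛ)

    incoming⇒egr-edge : ∀ u* c pe σ → incomingAt u* c σ ≡ true →
                        Σ (Fin (length z)) λ j → (β (u* , c , pe) ≡ fsuc j) × (σ ≡ lookup z j)
    incoming⇒egr-edge u* c pe σ h =
      let (v* , h₁) = any-witness (allFin (suc n)) h
          (d , h₂)  = any-witness (allFin k) h₁
          pd        = trans (present-defined v* d) (∧-elimˡ h₂)
          e : edge (egr z) (β (v* , d , pd)) σ (β (u* , c , pe)) ≡ true
          e = trans (edge-pres isoE (v* , d , pd) σ (u* , c , pe)) (∧-elimʳ {presentAt v* d} h₂)
      in egr-edge-target z (β (v* , d , pd)) σ (β (u* , c , pe)) e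

    egr-edge⇒incoming : ∀ u* c pe j → β (u* , c , pe) ≡ fsuc j → incomingAt u* c (lookup z j) ≡ true
    egr-edge⇒incoming u* c pe j eq =
      let p@(v* , d , pd) = from (bij isoE) (inject₁ j)
          e : edgeRel (outputGraph Te (rooted g)) p (lookup z j) (u* , c , pe) ≡ true
          e = trans (sym (edge-pres isoE p (lookup z j) (u* , c , pe)))
                    (trans (cong₂ (λ x y → edge (egr z) x (lookup z j) y) (strictlyInverseˡ (bij isoE) (inject₁ j)) eq)
                           (egr-edge-inject₁ z j))
      in allFin-complete _ v* (allFin-complete _ d (∧-intro (trans (sym (present-defined v* d)) pd) e))

    edgeLabel : Fin (suc n) → Fin k → Maybe (Fin b)
    edgeLabel u* c = uniqueWitness (λ σ → presentAt u* c ∧ incomingAt u* c σ)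

    edgeLabel-suc : ∀ u* c pe j → β (u* , c , pe) ≡ fsuc j → edgeLabel u* c ≡ just (lookup z j)
    edgeLabel-suc u* c pe j eq = uniqueWitness-complete _ (lookup z j)
      (∧-intro (trans (sym (present-defined u* c)) pe) (egr-edge⇒incoming u* c pe j eq))
      (λ σ′ h → let (j′ , e₁ , e₂) = incoming⇒egr-edge u* c pe σ′ (∧-elimʳ {presentAt u* c} h)
                in trans e₂ (cong (lookup z) (FP.suc-injective (trans (sym e₁) eq))))

    isSuc : ∀ {L} → Fin (suc L) → Bool
    isSuc fzero    = false
    isSuc (fsuc _) = true

    edgeLabel-defined : ∀ u* c → is-just (edgeLabel u* c) ≡ true →
                        Σ (is-just (copyLabel (rooted g) (nodeF Te) u* c) ≡ true) λ pe → isSuc (β (u* , c , pe)) ≡ true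
    edgeLabel-defined u* c h with edgeLabel u* c in e
    ... | just σ =
      let (pσ , _) = uniqueWitness-sound _ σ e
          pe = trans (present-defined u* c) (∧-elimˡ pσ)
          (j , e₁ , _) = incoming⇒egr-edge u* c pe σ (∧-elimʳ {presentAt u* c} pσ)
      in pe , subst (λ x → isSuc x ≡ true) (sym e₁) refl

    label-inj₁ : ∀ u c → copyLabel g nodeFs u (inj₁ c) ≡ edgeLabel (fsuc u) c
    label-inj₁ u c = uniqueWitness-cong (eval-node-inj₁ u c)

    label-inj₂ : ∀ u c → isFirst g u ≡ true → copyLabel g nodeFs u (inj₂ c) ≡ edgeLabel fzero c
    label-inj₂ u c f = uniqueWitness-cong (λ σ → trans (eval-node-inj₂ u c σ) (cong (_∧ _) f))

    inj₂-on-first : ∀ u c → is-just (copyLabel g nodeFs u (inj₂ c)) ≡ true → isFirst g u ≡ true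
    inj₂-on-first u c pr = decidable-stable (isFirst g u B.≟ true) λ ¬f → true≢false pr
      (cong is-just (uniqueWitness-none _ (λ σ → trans (eval-node-inj₂ u c σ) (cong (_∧ _) (¬-not ¬f)))))

    firstNode : Fin (length z) → Σ (Fin n) λ u → isFirst g u ≡ true
    firstNode j = first-exists {w = w} isoN (nonempty-source w z hz j)

    NonRoot : Set
    NonRoot = Σ Eout λ q → isSuc (β q) ≡ true

    toNonRoot : Nout → NonRoot
    toNonRoot (u , inj₁ c , pr) =
      let (pe , ps) = edgeLabel-defined (fsuc u) c (trans (cong is-just (sym (label-inj₁ u c))) pr) in (fsuc u , c , pe) , ps
    toNonRoot (u , inj₂ c , pr) =
      let (pe , ps) = edgeLabel-defined fzero c (trans (cong is-just (sym (label-inj₂ u c (inj₂-on-first u c pr)))) pr) in (fzero , c , pe) , ps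

    isSuc⇒suc : ∀ {L} {x : Fin (suc L)} → isSuc x ≡ true → Σ (Fin L) λ j → x ≡ fsuc j
    isSuc⇒suc {x = fsuc j} _ = j , refl

    fromNonRoot : NonRoot → Nout
    fromNonRoot ((fsuc u , c , pe) , ps) =
      let (j , e) = isSuc⇒suc ps in
      u , inj₁ c , trans (cong is-just (label-inj₁ u c)) (cong is-just (edgeLabel-suc (fsuc u) c pe j e))
    fromNonRoot ((fzero , c , pe) , ps) =
      let (j , e) = isSuc⇒suc ps
          (u₀ , f₀) = firstNode j
      in u₀ , inj₂ c , trans (cong is-just (label-inj₂ u₀ c f₀)) (cong is-just (edgeLabel-suc fzero c pe j e))

    NonRoot-≡ : ∀ {u* u*′ c c′ pe pe′ ps ps′} → u* ≡ u*′ → c ≡ c′ →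
                _≡_ {A = NonRoot} ((u* , c , pe) , ps) ((u*′ , c′ , pe′) , ps′)
    NonRoot-≡ {pe = pe} {pe′ = pe′} {ps} {ps′} refl refl with bool-≡-irrelevant pe pe′
    ... | refl = cong (λ y → (_ , _ , pe) , y) (bool-≡-irrelevant ps ps′)

    Nout↔NonRoot : Nout ↔ NonRoot
    Nout↔NonRoot = mk↔ₛ′ toNonRoot fromNonRoot
      (λ { ((fsuc u , c , pe) , ps) → NonRoot-≡ refl refl ; ((fzero , c , pe) , ps) → NonRoot-≡ refl refl })
      (λ { (u , inj₁ c , pr) → OutNode-≡ {g = g} {nodeFs = nodeFs} refl refl
         ; (u , inj₂ c , pr) → OutNode-≡ {g = g} {nodeFs = nodeFs}
             (isFirst-unique {w = w} isoN _ u (proj₂ (firstNode (proj₁ (isSuc⇒suc (proj₂ (toNonRoot (u , inj₂ c , pr)))))))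
                                             (inj₂-on-first u c pr))
             refl })

    NonRoot↔Fin : NonRoot ↔ Fin (length z)
    NonRoot↔Fin = ↔-trans (Σ-≡true-↔ (bij isoE) (λ q → isSuc (β q)) isSuc (λ _ → refl))
                          (mk↔ₛ′ (λ { (fsuc y , _) → y ; (fzero , ()) }) (λ y → fsuc y , refl) (λ _ → refl) (λ { (fsuc y , refl) → refl }))

    Nout↔Fin : Nout ↔ Fin (length z)
    Nout↔Fin = ↔-trans Nout↔NonRoot NonRoot↔Fin

    β-toNonRoot : ∀ p → β (proj₁ (toNonRoot p)) ≡ fsuc (to Nout↔Fin p)
    β-toNonRoot p with β (proj₁ (toNonRoot p)) | proj₂ (toNonRoot p)
    ... | fsuc _ | refl = refl

    output≃ngr : outputOver g nodeFs edgeFs ≃ abstractGraph (ngr z)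
    output≃ngr = record { bij = Nout↔Fin ; lab-pres = labels ; edge-pres = edges }
      where
        labels : ∀ p → lookup z (to Nout↔Fin p) ≡ nodeLab (outputOver g nodeFs edgeFs) p
        labels p@(u , inj₁ c , pr) =
          sym (fromJust-cong (trans (label-inj₁ u c) (edgeLabel-suc (fsuc u) c _ _ (β-toNonRoot p))) pr refl)
        labels p@(u , inj₂ c , pr) =
          sym (fromJust-cong (trans (label-inj₂ u c (inj₂-on-first u c pr)) (edgeLabel-suc fzero c _ _ (β-toNonRoot p))) pr refl)
        same-edge : ∀ p p′ σ →
          eval (rooted g) (edgeForm Te (reduce (copy p)) (reduce (copy p′)) σ)
                          (place (copy p) (proj₁ p) ∷ᵛ place (copy p′) (proj₁ p′) ∷ᵛ []ᵛ) []ᵛ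
          ≡ edgeRel (outputGraph Te (rooted g)) (proj₁ (toNonRoot p)) σ (proj₁ (toNonRoot p′))
        same-edge (_ , inj₁ _ , _) (_ , inj₁ _ , _) σ = refl
        same-edge (_ , inj₁ _ , _) (_ , inj₂ _ , _) σ = refl
        same-edge (_ , inj₂ _ , _) (_ , inj₁ _ , _) σ = refl
        same-edge (_ , inj₂ _ , _) (_ , inj₂ _ , _) σ = refl
        edges : ∀ p γ p′ → edge (ngr z) (to Nout↔Fin p) γ (to Nout↔Fin p′) ≡ edgeRel (outputOver g nodeFs edgeFs) p γ p′
        edges p γ p′ = sym (begin
          eval g (edgeFs (copy p) (copy p′) γ) (proj₁ p ∷ᵛ proj₁ p′ ∷ᵛ []ᵛ) []ᵛ
            ≡⟨ eval-edge (copy p) (copy p′) γ (proj₁ p) (proj₁ p′) ⟩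
          any (λ σ → eval (rooted g) (edgeForm Te (reduce (copy p)) (reduce (copy p′)) σ)
                                     (place (copy p) (proj₁ p) ∷ᵛ place (copy p′) (proj₁ p′) ∷ᵛ []ᵛ) []ᵛ) (allFin b)
            ≡⟨ any-cong (λ σ → trans (same-edge p p′ σ) (sym (edge-pres isoE (proj₁ (toNonRoot p)) σ (proj₁ (toNonRoot p′))))) (allFin b) ⟩
          any (λ σ → edge (egr z) (β (proj₁ (toNonRoot p))) σ (β (proj₁ (toNonRoot p′)))) (allFin b)
            ≡⟨ cong₂ (λ x y → any (λ σ → edge (egr z) x σ y) (allFin b)) (β-toNonRoot p) (β-toNonRoot p′) ⟩
          any (λ σ → edge (egr z) (fsuc (to Nout↔Fin p)) σ (fsuc (to Nout↔Fin p′))) (allFin b)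
            ≡⟨ any-egr-edge z (to Nout↔Fin p) (to Nout↔Fin p′) ⟩
          edge (ngr z) (to Nout↔Fin p) γ (to Nout↔Fin p′) ∎)
          where open ≡-Reasoning

    nodeT-output : output nodeT g ≅ ngr z
    nodeT-output = ≃⇒≅ (≃-trans (output≃outputGraph nodeT g) (≃-trans (outputOver-reindex g FP.+↔⊎ nodeFs edgeFs) output≃ngr))

MSOe⇒MSOn : ∀ {a b} (m : Transduction a b) → MSOe m → (∀ z → m [] z → z ≡ []) → MSOn m
MSOe⇒MSOn {a} m (Te , De) ε-only-to-ε = nodeT , defines
  where
    open Rooted {a}
    open NodeTransducer Te

    defines : Defines nodeT (ngrRel m)
    defines g h = sound , complete
      where
        open Semantics g

        output-ngr : ∀ {w z} → m w z → g ≅ ngr w → output Te (rooted g) ≅ egr z → output nodeT g ≅ ngr z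
        output-ngr {w} {z} mwz g≅w out≅z =
          Output.nodeT-output g {w} g≅w (≃-trans (≃-sym (output≃outputGraph Te (rooted g))) (≅⇒≃ out≅z))
                              (λ w≡[] → ε-only-to-ε z (subst (λ w → m w z) w≡[] mwz))

        sound : ngrRel m g h → (eval g (dom nodeT) []ᵛ []ᵛ ≡ true) × (h ≅ output nodeT g)
        sound (w , z , mwz , g≅w , h≅z) =
          let (dom-true , z≅out) = proj₁ (De (rooted g) (egr z)) (w , z , mwz , ≅-ngr⇒rooted-≅-egr {w = w} g≅w , ≅-refl)
          in trans eval-dom dom-true , ≅-trans h≅z (≅-sym (output-ngr mwz g≅w (≅-sym z≅out)))

        complete : (eval g (dom nodeT) []ᵛ []ᵛ ≡ true) × (h ≅ output nodeT g) → ngrRel m g h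
        complete (dom-true , h≅out) =
          let (w , z , mwz , rooted≅w , out≅z) = proj₂ (De (rooted g) (output Te (rooted g))) (trans (sym eval-dom) dom-true , ≅-refl)
              g≅w = rooted-≅-egr⇒≅-ngr {w = w} rooted≅w
          in w , z , mwz , g≅w , ≅-trans h≅out (output-ngr mwz g≅w out≅z)

-- The node graph of a rooted edge-labelled graph

punchIn≢ : ∀ {n} (r : Fin (suc n)) y → ¬ r ≡ punchIn r y
punchIn≢ r y e = FP.punchInᵢ≢i r y (sym e)

punchOut-punchIn : ∀ {n} (r : Fin (suc n)) y (r≢ : ¬ r ≡ punchIn r y) → punchOut r≢ ≡ y
punchOut-punchIn r y r≢ = trans (FP.punchOut-cong r refl) (FP.punchOut-punchIn r)

any-punchIn : ∀ {n} (r : Fin (suc n)) (h P : Fin (suc n) → Bool) (Q : Fin n → Bool) →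
              (∀ x → h x ≡ true → ¬ r ≡ x) → (∀ x → ¬ r ≡ x → h x ≡ true) → (∀ y → P (punchIn r y) ≡ Q y) →
              any (λ x → h x ∧ P x) (allFin (suc n)) ≡ any Q (allFin n)
any-punchIn {n} r h P Q h⇒≢ ≢⇒h e = ≡true-ext
  (λ t → let (x , hx) = any-witness (allFin (suc n)) t
             r≢x = h⇒≢ x (∧-elimˡ hx)
         in allFin-complete Q (punchOut r≢x) (trans (sym (e (punchOut r≢x))) (trans (cong P (FP.punchIn-punchOut r≢x)) (∧-elimʳ {h x} hx))))
  (λ t → let (y , hy) = any-witness (allFin n) t
         in allFin-complete _ (punchIn r y) (∧-intro (≢⇒h _ (punchIn≢ r y)) (trans (e y) hy)))

any-allSubsets-punchIn : ∀ {n} (r : Fin (suc n)) (P : Vec Bool (suc n) → Bool) (Q : Vec Bool n → Bool) →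
                         (∀ U U₀ → (∀ y → V.lookup U (punchIn r y) ≡ V.lookup U₀ y) → P U ≡ Q U₀) →
                         any P (allSubsets (suc n)) ≡ any Q (allSubsets n)
any-allSubsets-punchIn {n} r P Q e = ≡true-ext
  (λ t → let (U , hU) = any-witness (allSubsets (suc n)) t
             U₀ = V.tabulate (λ y → V.lookup U (punchIn r y))
         in allSubsets-complete Q U₀ (trans (sym (e U U₀ (λ y → sym (VP.lookup∘tabulate _ y)))) hU))
  (λ t → let (U₀ , hU) = any-witness (allSubsets n) t
         in allSubsets-complete P (extendAt U₀) (trans (e (extendAt U₀) U₀ (lookup-extendAt U₀)) hU))
  where
    at : ∀ {x} → Vec Bool n → Dec (r ≡ x) → Bool
    at U₀ (yes _)  = false
    at U₀ (no r≢x) = V.lookup U₀ (punchOut r≢x)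
    extendAt : Vec Bool n → Vec Bool (suc n)
    extendAt U₀ = V.tabulate (λ x → at U₀ (r F.≟ x))
    lookup-extendAt : ∀ U₀ y → V.lookup (extendAt U₀) (punchIn r y) ≡ V.lookup U₀ y
    lookup-extendAt U₀ y with r F.≟ punchIn r y | VP.lookup∘tabulate (λ x → at U₀ (r F.≟ x)) (punchIn r y)
    ... | yes r≡ | _ = ⊥-elim (punchIn≢ r y r≡)
    ... | no r≢  | e = trans e (cong (V.lookup U₀) (punchOut-punchIn r y r≢))

module Relativize {a : ℕ} where

  HasIncoming : ∀ {i j} → Fin i → Formula 1 a i j
  HasIncoming x = ex1 (bigOr a (λ γ → edgeF γ fzero (fsuc x)))

  -- Node formulas are evaluated on the nodes with an incoming edge; a node label becomes
  -- the label of the incoming edge.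
  relativize : ∀ {i j} → Formula a 1 i j → Formula 1 a i j
  relativize (labF σ x)    = ex1 (edgeF σ fzero (fsuc x))
  relativize (edgeF _ x y) = bigOr a (λ γ → edgeF γ x y)
  relativize (eqF x y)     = eqF x y
  relativize (memF x X)    = memF x X
  relativize (negF φ)      = negF (relativize φ)
  relativize (andF φ ψ)    = andF (relativize φ) (relativize ψ)
  relativize (orF φ ψ)     = orF (relativize φ) (relativize ψ)
  relativize (ex1 φ)       = ex1 (andF (HasIncoming fzero) (relativize φ))
  relativize (all1 φ)      = all1 (orF (negF (HasIncoming fzero)) (relativize φ))
  relativize (ex2 φ)       = ex2 (relativize φ)
  relativize (all2 φ)      = all2 (relativize φ)

  uniqueSource : Formula 1 a 0 0
  uniqueSource = ex1 (andF (negF (HasIncoming fzero)) (all1 (orF (HasIncoming fzero) (eqF fzero (fsuc fzero)))))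

  sameLabel : ∀ {i j} → Fin a → Fin a → Formula 1 a i j
  sameLabel γ γ′ = if ⌊ γ F.≟ γ′ ⌋ then ⊤F else ⊥F

  inDegree≤1 : Formula 1 a 0 0
  inDegree≤1 = all1 (all1 (all1 (bigAnd a (λ γ → bigAnd a (λ γ′ →
    orF (negF (andF (edgeF γ (fsuc fzero) (fsuc (fsuc fzero))) (edgeF γ′ fzero (fsuc (fsuc fzero)))))
        (andF (eqF (fsuc fzero) fzero) (sameLabel γ γ′)))))))

  stringShape : Formula 1 a 0 0
  stringShape = andF uniqueSource inDegree≤1

  module OnGraph (n : ℕ) (lb : Fin (suc n) → Fin 1) (ed : Fin (suc n) → Fin a → Fin (suc n) → Bool) where

    G : Graph 1 a
    G = record { size = suc n ; lab = lb ; edge = ed }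

    hasIncoming : Fin (suc n) → Bool
    hasIncoming x = any (λ v → any (λ γ → ed v γ x) (allFin a)) (allFin (suc n))

    eval-HasIncoming : ∀ {i j} (x : Fin i) ρ (η : Vec (Vec Bool (suc n)) j) → eval G (HasIncoming x) ρ η ≡ hasIncoming (V.lookup ρ x)
    eval-HasIncoming x ρ η = any-cong (λ v → eval-bigOr G a _ (v ∷ᵛ ρ) η) (allFin (suc n))

    record Rooted-at (r : Fin (suc n)) (L : Fin n → Fin a) : Set where
      field
        incoming⇒≢root : ∀ x → hasIncoming x ≡ true → ¬ r ≡ x
        ≢root⇒incoming : ∀ x → ¬ r ≡ x → hasIncoming x ≡ true
        incoming-label  : ∀ y σ → any (λ v → ed v σ (punchIn r y)) (allFin (suc n)) ≡ ⌊ L y F.≟ σ ⌋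

    nodeGraph : Fin (suc n) → (Fin n → Fin a) → Graph a 1
    nodeGraph r L = record { size = n ; lab = L ; edge = λ y _ y′ → any (λ γ → ed (punchIn r y) γ (punchIn r y′)) (allFin a) }

    module _ {r : Fin (suc n)} {L : Fin n → Fin a} (R : Rooted-at r L) where
      open Rooted-at R

      eval-relativize : ∀ {i j} (φ : Formula a 1 i j) (ρ : Vec (Fin (suc n)) i) (η : Vec (Vec Bool (suc n)) j)
                        (ρ₀ : Vec (Fin n) i) (η₀ : Vec (Vec Bool n) j) →
                        (∀ x → V.lookup ρ x ≡ punchIn r (V.lookup ρ₀ x)) →
                        (∀ X y → V.lookup (V.lookup η X) (punchIn r y) ≡ V.lookup (V.lookup η₀ X) y) →
                        eval G (relativize φ) ρ η ≡ eval (nodeGraph r L) φ ρ₀ η₀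
      eval-relativize (labF σ x) ρ η ρ₀ η₀ hρ hη rewrite hρ x = incoming-label (V.lookup ρ₀ x) σ
      eval-relativize (edgeF γ x y) ρ η ρ₀ η₀ hρ hη rewrite eval-bigOr G a (λ γ → edgeF γ x y) ρ η | hρ x | hρ y = refl
      eval-relativize (eqF x y) ρ η ρ₀ η₀ hρ hη rewrite hρ x | hρ y =
        ≡true-ext (λ e → ≟-true (FP.punchIn-injective r _ _ (≟-sound e))) (λ e → ≟-true (cong (punchIn r) (≟-sound e)))
      eval-relativize (memF x X) ρ η ρ₀ η₀ hρ hη rewrite hρ x = hη X (V.lookup ρ₀ x)
      eval-relativize (negF φ)   ρ η ρ₀ η₀ hρ hη = cong not (eval-relativize φ ρ η ρ₀ η₀ hρ hη)
      eval-relativize (andF φ ψ) ρ η ρ₀ η₀ hρ hη =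
        cong₂ _∧_ (eval-relativize φ ρ η ρ₀ η₀ hρ hη) (eval-relativize ψ ρ η ρ₀ η₀ hρ hη)
      eval-relativize (orF φ ψ)  ρ η ρ₀ η₀ hρ hη =
        cong₂ _∨_ (eval-relativize φ ρ η ρ₀ η₀ hρ hη) (eval-relativize ψ ρ η ρ₀ η₀ hρ hη)
      eval-relativize (ex1 φ) ρ η ρ₀ η₀ hρ hη =
        trans (any-cong (λ x → cong (_∧ eval G (relativize φ) (x ∷ᵛ ρ) η) (eval-HasIncoming fzero (x ∷ᵛ ρ) η)) (allFin (suc n)))
              (any-punchIn r hasIncoming _ _ incoming⇒≢root ≢root⇒incoming
                 (λ y → eval-relativize φ (punchIn r y ∷ᵛ ρ) η (y ∷ᵛ ρ₀) η₀ (λ { fzero → refl ; (fsuc x) → hρ x }) hη))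
      eval-relativize (all1 φ) ρ η ρ₀ η₀ hρ hη =
        cong not (trans (any-cong (λ x → trans (cong (λ t → not (not t ∨ eval G (relativize φ) (x ∷ᵛ ρ) η)) (eval-HasIncoming fzero (x ∷ᵛ ρ) η))
                                                (not-¬∨ (hasIncoming x) _))
                                  (allFin (suc n)))
                        (any-punchIn r hasIncoming _ _ incoming⇒≢root ≢root⇒incoming
                           (λ y → cong not (eval-relativize φ (punchIn r y ∷ᵛ ρ) η (y ∷ᵛ ρ₀) η₀ (λ { fzero → refl ; (fsuc x) → hρ x }) hη))))
        where
          not-¬∨ : ∀ a b → not (not a ∨ b) ≡ a ∧ not b
          not-¬∨ true  b = refl
          not-¬∨ false b = refl
      eval-relativize (ex2 φ) ρ η ρ₀ η₀ hρ hη =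
        any-allSubsets-punchIn r _ _ (λ U U₀ hU → eval-relativize φ ρ (U ∷ᵛ η) ρ₀ (U₀ ∷ᵛ η₀) hρ (λ { fzero y → hU y ; (fsuc X) y → hη X y }))
      eval-relativize (all2 φ) ρ η ρ₀ η₀ hρ hη =
        cong not (any-allSubsets-punchIn r _ _ (λ U U₀ hU →
          cong not (eval-relativize φ ρ (U ∷ᵛ η) ρ₀ (U₀ ∷ᵛ η₀) hρ (λ { fzero y → hU y ; (fsuc X) y → hη X y }))))

    InDegree≤1 : Set
    InDegree≤1 = ∀ x v v′ γ γ′ → ed v γ x ≡ true → ed v′ γ′ x ≡ true → (v ≡ v′) × (γ ≡ γ′)

    eval-sameLabel : ∀ {i j} γ γ′ (ρ : Vec (Fin (suc n)) i) (η : Vec (Vec Bool (suc n)) j) → eval G (sameLabel γ γ′) ρ η ≡ ⌊ γ F.≟ γ′ ⌋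
    eval-sameLabel γ γ′ ρ η with γ F.≟ γ′
    ... | yes _ = eval-⊤F G ρ η
    ... | no _  = eval-⊥F G ρ η

    uniqueSource⁻ : eval G uniqueSource []ᵛ []ᵛ ≡ true →
                    Σ (Fin (suc n)) λ r → (hasIncoming r ≡ false) × (∀ x → hasIncoming x ≡ false → x ≡ r)
    uniqueSource⁻ e =
      let (r , h) = any-witness (allFin (suc n)) e
          no-in   = not-≡true (trans (sym (cong not (eval-HasIncoming fzero (r ∷ᵛ []ᵛ) []ᵛ))) (∧-elimˡ h))
          others  = allL-allFin⁻ _ (∧-elimʳ {not (eval G (HasIncoming fzero) (r ∷ᵛ []ᵛ) []ᵛ)} h)
      in r , no-in , λ x hx → ∨-elim (others x)
                                     (λ t → ⊥-elim (true≢false (trans (sym (eval-HasIncoming fzero (x ∷ᵛ r ∷ᵛ []ᵛ) []ᵛ)) t) hx))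
                                     ≟-sound

    uniqueSource⁺ : (r : Fin (suc n)) → hasIncoming r ≡ false → (∀ x → hasIncoming x ≡ false → x ≡ r) →
                    eval G uniqueSource []ᵛ []ᵛ ≡ true
    uniqueSource⁺ r no-in others = allFin-complete _ r (∧-intro (trans (cong not (eval-HasIncoming fzero (r ∷ᵛ []ᵛ) []ᵛ)) (not-≡false no-in))
                                                                 (allL-allFin⁺ _ (λ x → by-value x (hasIncoming x) refl)))
      where
        by-value : ∀ x b → hasIncoming x ≡ b → (eval G (HasIncoming fzero) (x ∷ᵛ r ∷ᵛ []ᵛ) []ᵛ ∨ ⌊ x F.≟ r ⌋) ≡ true
        by-value x true  e = ∨-introˡ (trans (eval-HasIncoming fzero (x ∷ᵛ r ∷ᵛ []ᵛ) []ᵛ) e)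
        by-value x false e = ∨-introʳ {eval G (HasIncoming fzero) (x ∷ᵛ r ∷ᵛ []ᵛ) []ᵛ} (≟-true (others x e))

    inDegree≤1⁻ : eval G inDegree≤1 []ᵛ []ᵛ ≡ true → InDegree≤1
    inDegree≤1⁻ e x v v′ γ γ′ h₁ h₂ =
      let t  = eval-bigAnd⁻ G a _ _ []ᵛ (eval-bigAnd⁻ G a _ _ []ᵛ (allL-allFin⁻ _ (allL-allFin⁻ _ (allL-allFin⁻ _ e x) v) v′) γ) γ′
          t′ = ∨-elim t (λ c → ⊥-elim (true≢false (∧-intro h₁ h₂) (not-≡true c))) (λ c → c)
      in ≟-sound (∧-elimˡ t′) , ≟-sound (trans (sym (eval-sameLabel γ γ′ (v′ ∷ᵛ v ∷ᵛ x ∷ᵛ []ᵛ) []ᵛ)) (∧-elimʳ {⌊ v F.≟ v′ ⌋} t′))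

    inDegree≤1⁺ : InDegree≤1 → eval G inDegree≤1 []ᵛ []ᵛ ≡ true
    inDegree≤1⁺ u = allL-allFin⁺ _ λ x → allL-allFin⁺ _ λ v → allL-allFin⁺ _ λ v′ →
                    eval-bigAnd⁺ G a _ _ []ᵛ λ γ → eval-bigAnd⁺ G a _ _ []ᵛ λ γ′ → by-value x v v′ γ γ′ (ed v γ x ∧ ed v′ γ′ x) refl
      where
        by-value : ∀ x v v′ γ γ′ b → (ed v γ x ∧ ed v′ γ′ x) ≡ b →
                   eval G (orF (negF (andF (edgeF γ (fsuc fzero) (fsuc (fsuc fzero))) (edgeF γ′ fzero (fsuc (fsuc fzero)))))
                               (andF (eqF (fsuc fzero) fzero) (sameLabel γ γ′))) (v′ ∷ᵛ v ∷ᵛ x ∷ᵛ []ᵛ) []ᵛ ≡ true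
        by-value x v v′ γ γ′ false e = ∨-introˡ (not-≡false e)
        by-value x v v′ γ γ′ true  e = let (e₁ , e₂) = u x v v′ γ γ′ (∧-elimˡ e) (∧-elimʳ {ed v γ x} e) in
          ∨-introʳ {not (ed v γ x ∧ ed v′ γ′ x)} (∧-intro (≟-true e₁) (trans (eval-sameLabel γ γ′ (v′ ∷ᵛ v ∷ᵛ x ∷ᵛ []ᵛ) []ᵛ) (≟-true e₂)))

    module FromShape (r : Fin (suc n)) (r-source : hasIncoming r ≡ false) (r-unique : ∀ x → hasIncoming x ≡ false → x ≡ r)
                     (in≤1 : InDegree≤1) where

      incoming⇒≢root : ∀ x → hasIncoming x ≡ true → ¬ r ≡ x
      incoming⇒≢root x h r≡x = true≢false (subst (λ y → hasIncoming y ≡ true) (sym r≡x) h) r-source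

      ≢root⇒incoming : ∀ x → ¬ r ≡ x → hasIncoming x ≡ true
      ≢root⇒incoming x r≢x = decidable-stable (hasIncoming x B.≟ true) λ ¬h → r≢x (sym (r-unique x (¬-not ¬h)))

      incoming-edge : ∀ y → Σ (Fin (suc n)) λ v → Σ (Fin a) λ γ → ed v γ (punchIn r y) ≡ true
      incoming-edge y = let (v , h)  = any-witness (allFin (suc n)) (≢root⇒incoming (punchIn r y) (punchIn≢ r y))
                            (γ , h′) = any-witness (allFin a) h
                        in v , γ , h′

      L : Fin n → Fin a
      L y = proj₁ (proj₂ (incoming-edge y))

      rooted-at : Rooted-at r L
      rooted-at = record
        { incoming⇒≢root = incoming⇒≢root
        ; ≢root⇒incoming = ≢root⇒incoming
        ; incoming-label  = λ y σ → ≡true-ext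
            (λ e → let (v , h) = any-witness (allFin (suc n)) e
                   in ≟-true (sym (proj₂ (in≤1 _ _ _ _ _ h (proj₂ (proj₂ (incoming-edge y)))))))
            (λ e → let (v , γ , h) = incoming-edge y
                   in allFin-complete (λ v → ed v σ (punchIn r y)) v (subst (λ s → ed v s (punchIn r y) ≡ true) (≟-sound e) h))
        }

      module _ {w : List (Fin a)} (iso : nodeGraph r L ≅ ngr w) where
        private
          b  = _≅_.bij iso
          β  = to b
          β⁻ = from b

        private
          insert-self : ∀ {m k} (i : Fin (suc m)) (j : Fin (suc k)) π → to (insert i j π) i ≡ j
          insert-self i j π with i F.≟ i
          ... | yes _   = refl
          ... | no i≢i = ⊥-elim (i≢i refl)

          view : ∀ x → (r ≡ x) ⊎ Σ (Fin n) λ y → punchIn r y ≡ x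
          view x with r F.≟ x
          ... | yes r≡x = inj₁ r≡x
          ... | no r≢x  = inj₂ (punchOut r≢x , FP.punchIn-punchOut r≢x)

          label-β : ∀ y → lookup w (β y) ≡ L y
          label-β = _≅_.lab-pres iso

          label-of-edge : ∀ v σ y → ed v σ (punchIn r y) ≡ true → σ ≡ L y
          label-of-edge v σ y h = sym (≟-sound (trans (sym (Rooted-at.incoming-label rooted-at y σ)) (allFin-complete (λ v → ed v σ (punchIn r y)) v h)))

          edge-with-label : ∀ y → Σ (Fin (suc n)) λ v → ed v (L y) (punchIn r y) ≡ true
          edge-with-label y = any-witness (allFin (suc n)) (trans (Rooted-at.incoming-label rooted-at y (L y)) (≟-true refl))

          nodeEdge⁻ : ∀ y y′ → any (λ γ → ed (punchIn r y) γ (punchIn r y′)) (allFin a) ≡ true → toℕ (β y′) ≡ suc (toℕ (β y))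
          nodeEdge⁻ y y′ h = ngr-edge⁻ w (β y) fzero (β y′) (trans (_≅_.edge-pres iso y fzero y′) h)

          nodeEdge⁺ : ∀ y y′ → toℕ (β y′) ≡ suc (toℕ (β y)) → any (λ γ → ed (punchIn r y) γ (punchIn r y′)) (allFin a) ≡ true
          nodeEdge⁺ y y′ e = trans (sym (_≅_.edge-pres iso y fzero y′)) (ngr-edge⁺ w (β y) fzero (β y′) e)

          no-edge-into-root : ∀ x γ → ed x γ r ≡ false
          no-edge-into-root x γ = ¬-not (λ h → true≢false (allFin-complete _ x (allFin-complete (λ γ → ed x γ r) γ h)) r-source)

          -- A successor of the root with a predecessor y″ in the node graph would have two
          -- incoming edges.
          root-edge⇒first : ∀ γ y′ → ed r γ (punchIn r y′) ≡ true → toℕ (β y′) ≡ 0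
          root-edge⇒first γ y′ h = decidable-stable (toℕ (β y′) ℕ.≟ 0) λ y′≢0 →
            let (j , y′≡1+j) = toℕ≢0⇒predecessor (β y′) y′≢0
                y″ = β⁻ j
                (γ′ , h′) = any-witness (allFin a) (nodeEdge⁺ y″ y′ (trans y′≡1+j (cong (λ t → suc (toℕ t)) (sym (strictlyInverseˡ b j)))))
            in punchIn≢ r y″ (proj₁ (in≤1 (punchIn r y′) r (punchIn r y″) γ γ′ h h′))

          edge-from-root : ∀ γ y′ → edge (egr w) fzero γ (fsuc (β y′)) ≡ ed r γ (punchIn r y′)
          edge-from-root γ y′ = ≡true-ext
            (λ e → let (y′≡0 , γ≡) = egr-edge-0⁻ w γ (β y′) e
                       (v , hv) = edge-with-label y′
                   in from-source v (view v) y′≡0 (trans γ≡ (label-β y′)) hv)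
            (λ h → egr-edge-0⁺ w γ (β y′) (root-edge⇒first γ y′ h) (trans (label-of-edge r γ y′ h) (sym (label-β y′))))
            where
              from-source : ∀ v → (r ≡ v) ⊎ Σ (Fin n) (λ y → punchIn r y ≡ v) → toℕ (β y′) ≡ 0 → γ ≡ L y′ →
                            ed v (L y′) (punchIn r y′) ≡ true → ed r γ (punchIn r y′) ≡ true
              from-source v (inj₁ refl) _ γ≡ hv = subst (λ s → ed r s (punchIn r y′) ≡ true) (sym γ≡) hv
              from-source v (inj₂ (v₀ , refl)) y′≡0 _ hv =
                ⊥-elim (ℕ.0≢1+n (trans (sym y′≡0) (nodeEdge⁻ v₀ y′ (allFin-complete (λ γ → ed (punchIn r v₀) γ (punchIn r y′)) (L y′) hv))))

          edge-between : ∀ y γ y′ → edge (egr w) (fsuc (β y)) γ (fsuc (β y′)) ≡ ed (punchIn r y) γ (punchIn r y′)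
          edge-between y γ y′ = ≡true-ext
            (λ e → let (e₁ , γ≡) = egr-edge-suc⁻ w γ (β y) (β y′) e
                       (γ′ , h′) = any-witness (allFin a) (nodeEdge⁺ y y′ e₁)
                   in subst (λ s → ed (punchIn r y) s (punchIn r y′) ≡ true)
                            (trans (label-of-edge _ γ′ y′ h′) (trans (sym (label-β y′)) (sym γ≡))) h′)
            (λ h → egr-edge-suc⁺ w γ (β y) (β y′) (nodeEdge⁻ y y′ (allFin-complete (λ γ → ed (punchIn r y) γ (punchIn r y′)) γ h))
                                 (trans (label-of-edge _ γ y′ h) (sym (label-β y′))))

        G≅egr : G ≅ egr w
        G≅egr = record { bij = insert r fzero b ; lab-pres = λ _ → Fin1-irrelevant _ _ ; edge-pres = edges }
          where
            to-r : to (insert r fzero b) r ≡ fzero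
            to-r = insert-self r fzero b
            to-punchIn : ∀ y → to (insert r fzero b) (punchIn r y) ≡ fsuc (β y)
            to-punchIn = insert-punchIn r fzero b
            edges : ∀ x γ x′ → edge (egr w) (to (insert r fzero b) x) γ (to (insert r fzero b) x′) ≡ ed x γ x′
            edges x γ x′ with view x | view x′
            ... | _ | inj₁ refl = trans (cong (λ t → edge (egr w) (to (insert r fzero b) x) γ t) to-r)
                                        (trans (egr-no-edge-into-0 w (to (insert r fzero b) x) γ) (sym (no-edge-into-root x γ)))
            ... | inj₁ refl | inj₂ (y′ , refl) = trans (cong₂ (λ s t → edge (egr w) s γ t) to-r (to-punchIn y′)) (edge-from-root γ y′)
            ... | inj₂ (y , refl) | inj₂ (y′ , refl) = trans (cong₂ (λ s t → edge (egr w) s γ t) (to-punchIn y) (to-punchIn y′)) (edge-between y γ y′)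

  module OnEgr (w : List (Fin a)) where
    open OnGraph (length w) (λ _ → fzero) (edge (egr w))

    egr-root-source : hasIncoming fzero ≡ false
    egr-root-source = ¬-not λ h →
      let (v , h₁) = any-witness (allFin (suc (length w))) h
          (γ , h₂) = any-witness (allFin a) h₁
      in true≢false h₂ (egr-no-edge-into-0 w v γ)

    egr-root-unique : ∀ x → hasIncoming x ≡ false → x ≡ fzero
    egr-root-unique fzero    _ = refl
    egr-root-unique (fsuc j) e = ⊥-elim (true≢false (allFin-complete _ (inject₁ j) (allFin-complete _ (lookup w j) (egr-edge-inject₁ w j))) e)

    egr-in≤1 : InDegree≤1
    egr-in≤1 fzero    v v′ γ γ′ h₁ _  = ⊥-elim (true≢false h₁ (egr-no-edge-into-0 w v γ))
    egr-in≤1 (fsuc j) v v′ γ γ′ h₁ h₂ =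
      let (v≡ , γ≡) = egr-edge-into-suc w v γ j h₁ ; (v′≡ , γ′≡) = egr-edge-into-suc w v′ γ′ j h₂
      in trans v≡ (sym v′≡) , trans γ≡ (sym γ′≡)

    egr-shape : eval (egr w) stringShape []ᵛ []ᵛ ≡ true
    egr-shape = ∧-intro (uniqueSource⁺ fzero egr-root-source egr-root-unique) (inDegree≤1⁺ egr-in≤1)

    open FromShape fzero egr-root-source egr-root-unique egr-in≤1 public

    nodeGraph≅ngr : nodeGraph fzero L ≅ ngr w
    nodeGraph≅ngr = record
      { bij = ↔-refl
      ; lab-pres = λ y → let (v , γ , h) = incoming-edge y in sym (proj₂ (egr-edge-into-suc w v γ y h))
      ; edge-pres = λ y γ y′ → sym (any-egr-edge w y y′)
      }

-- From MSO_n to MSO_e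

module EdgeTransducer {a b : ℕ} (Tn : MSOT a 1 b 1) where
  open Relativize {a}

  private
    kn = copies Tn

  present : Fin kn → Formula a 1 1 0
  present c = exactlyOne b (nodeF Tn c)

  hasPredecessor : Fin kn → Formula a 1 1 0
  hasPredecessor d = ex1 (bigOr kn (λ c → andF (rename (λ _ → fzero) (present c)) (edgeForm Tn c d fzero)))

  initial : Fin kn → Fin b → Formula a 1 1 0
  initial d σ = andF (nodeF Tn d σ) (negF (hasPredecessor d))

  -- Copy inj₁ _ is the root of the output string, placed on the root of the input.
  Copy : Set
  Copy = Fin 1 ⊎ Fin kn

  nodeFs : Copy → Fin 1 → Formula 1 a 1 0
  nodeFs (inj₁ _) _ = negF (HasIncoming fzero)
  nodeFs (inj₂ c) _ = andF (HasIncoming fzero) (relativize (present c))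

  targetLabelled : Fin kn → Fin b → Formula a 1 2 0
  targetLabelled d σ = rename (λ _ → fsuc fzero) (nodeF Tn d σ)

  edgeFs : Copy → Copy → Fin b → Formula 1 a 2 0
  edgeFs _        (inj₁ _) σ = ⊥F
  edgeFs (inj₁ _) (inj₂ d) σ = andF (negF (HasIncoming fzero)) (rename (λ _ → fsuc fzero) (relativize (initial d σ)))
  edgeFs (inj₂ c) (inj₂ d) σ = relativize (andF (edgeForm Tn c d fzero) (targetLabelled d σ))

  edgeT : MSOT 1 a 1 b
  edgeT = record
    { dom      = andF stringShape (relativize (dom Tn))
    ; copies   = suc kn
    ; nodeF    = λ c → nodeFs (F.splitAt 1 c)
    ; edgeForm = λ c d → edgeFs (F.splitAt 1 c) (F.splitAt 1 d)
    }

  module Output (n : ℕ) (lb : Fin (suc n) → Fin 1) (ed : Fin (suc n) → Fin a → Fin (suc n) → Bool)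
                {r : Fin (suc n)} {L : Fin n → Fin a} (R : OnGraph.Rooted-at n lb ed r L)
                {z : List (Fin b)} (isoO : outputGraph Tn (OnGraph.nodeGraph n lb ed r L) ≃ abstractGraph (ngr z)) where
    open OnGraph n lb ed
    open Rooted-at R

    private
      Φ = nodeGraph r L
      β = to (bij isoO)
      β⁻ = from (bij isoO)
      Nout = OutNode Φ (nodeF Tn)
      Eout = OutNode G nodeFs

    eval-present : ∀ y c → eval G (relativize (present c)) (punchIn r y ∷ᵛ []ᵛ) []ᵛ ≡ is-just (copyLabel Φ (nodeF Tn) y c)
    eval-present y c = trans (eval-relativize R (present c) (punchIn r y ∷ᵛ []ᵛ) []ᵛ (y ∷ᵛ []ᵛ) []ᵛ (λ { fzero → refl }) (λ ()))
                             (eval-exactlyOne Φ b (nodeF Tn c) (y ∷ᵛ []ᵛ) []ᵛ)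

    copy-defined : ∀ x s → is-just (copyLabel G nodeFs x s) ≡ eval G (nodeFs s fzero) (x ∷ᵛ []ᵛ) []ᵛ
    copy-defined x s = is-just-uniqueWitness-Fin1 (λ σ → eval G (nodeFs s σ) (x ∷ᵛ []ᵛ) []ᵛ)

    module _ (x : Fin (suc n)) (c : Fin kn) (pr : is-just (copyLabel G nodeFs x (inj₂ c)) ≡ true) where
      private
        defined : eval G (nodeFs (inj₂ c) fzero) (x ∷ᵛ []ᵛ) []ᵛ ≡ true
        defined = trans (sym (copy-defined x (inj₂ c))) pr

        r≢x : ¬ r ≡ x
        r≢x = incoming⇒≢root x (trans (sym (eval-HasIncoming fzero (x ∷ᵛ []ᵛ) []ᵛ)) (∧-elimˡ defined))

      base : Fin n
      base = punchOut r≢x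

      punchIn-base : punchIn r base ≡ x
      punchIn-base = FP.punchIn-punchOut r≢x

      nodeOutput : Nout
      nodeOutput = base , c , trans (sym (eval-present base c))
                                    (trans (cong (λ x → eval G (relativize (present c)) (x ∷ᵛ []ᵛ) []ᵛ) punchIn-base)
                                           (∧-elimʳ {eval G (HasIncoming fzero) (x ∷ᵛ []ᵛ) []ᵛ} defined))

    root-defined : is-just (copyLabel G nodeFs r (inj₁ fzero)) ≡ true
    root-defined = trans (copy-defined r (inj₁ fzero))
                         (cong not (trans (eval-HasIncoming fzero (r ∷ᵛ []ᵛ) []ᵛ) (¬-not λ h → incoming⇒≢root r h refl)))

    on-root : ∀ x → is-just (copyLabel G nodeFs x (inj₁ fzero)) ≡ true → r ≡ x
    on-root x pr = decidable-stable (r F.≟ x) λ r≢x → true≢false (≢root⇒incoming x r≢x)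
      (trans (sym (eval-HasIncoming fzero (x ∷ᵛ []ᵛ) []ᵛ)) (not-≡true (trans (sym (copy-defined x (inj₁ fzero))) pr)))

    edgeOutput : Nout → Eout
    edgeOutput (y , c , pr) =
      punchIn r y , inj₂ c , trans (copy-defined _ (inj₂ c))
                                   (∧-intro (trans (eval-HasIncoming fzero _ []ᵛ) (≢root⇒incoming _ (punchIn≢ r y))) (trans (eval-present y c) pr))

    toFin : Eout → Fin (suc (length z))
    toFin (x , inj₁ _ , pr) = fzero
    toFin (x , inj₂ c , pr) = fsuc (β (nodeOutput x c pr))

    fromFin : Fin (suc (length z)) → Eout
    fromFin fzero    = r , inj₁ fzero , root-defined
    fromFin (fsuc j) = edgeOutput (β⁻ j)

    Eout↔Fin : Eout ↔ Fin (suc (length z))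
    Eout↔Fin = mk↔ₛ′ toFin fromFin
      (λ { fzero    → refl
         ; (fsuc j) → cong fsuc (trans (cong β (OutNode-≡ {g = Φ} {nodeFs = nodeF Tn} (punchOut-punchIn r _ _) refl)) (strictlyInverseˡ (bij isoO) j)) })
      (λ { (x , inj₁ fzero , pr) → OutNode-≡ {g = G} {nodeFs = nodeFs} (on-root x pr) refl
         ; (x , inj₂ c , pr) → let q = nodeOutput x c pr in
             OutNode-≡ {g = G} {nodeFs = nodeFs} (trans (cong (λ q → punchIn r (proj₁ q)) (strictlyInverseʳ (bij isoO) q)) (punchIn-base x c pr))
                                                 (cong (λ q → inj₂ (copy q)) (strictlyInverseʳ (bij isoO) q)) })

    eval-nodeF-output : ∀ (q : Nout) σ → eval Φ (nodeF Tn (copy q) σ) (proj₁ q ∷ᵛ []ᵛ) []ᵛ ≡ ⌊ lookup z (β q) F.≟ σ ⌋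
    eval-nodeF-output q@(y , c , pr) σ =
      let (holds , unique) = uniqueWitness-sound _ _ (just-fromJust (copyLabel Φ (nodeF Tn) y c) pr)
          label≡ = lab-pres isoO q
      in ≡true-ext (λ h → ≟-true (trans label≡ (sym (unique σ h))))
                   (λ h → subst (λ s → eval Φ (nodeF Tn c s) (y ∷ᵛ []ᵛ) []ᵛ ≡ true) (trans (sym label≡) (≟-sound h)) holds)

    predecessorAt : Fin n → Fin kn → Bool
    predecessorAt y′ d = any (λ v → any (λ c → is-just (copyLabel Φ (nodeF Tn) v c) ∧ eval Φ (edgeForm Tn c d fzero) (v ∷ᵛ y′ ∷ᵛ []ᵛ) []ᵛ)
                                        (allFin kn))
                             (allFin n)

    eval-initial : ∀ (q : Nout) σ → eval Φ (initial (copy q) σ) (proj₁ q ∷ᵛ []ᵛ) []ᵛ ≡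
                                    ⌊ lookup z (β q) F.≟ σ ⌋ ∧ not (predecessorAt (proj₁ q) (copy q))
    eval-initial q@(y , d , _) σ = cong₂ (λ x y → x ∧ not y) (eval-nodeF-output q σ)
      (any-cong (λ v → trans (eval-bigOr Φ kn _ (v ∷ᵛ y ∷ᵛ []ᵛ) []ᵛ)
        (any-cong (λ c → cong (_∧ eval Φ (edgeForm Tn c d fzero) (v ∷ᵛ y ∷ᵛ []ᵛ) []ᵛ)
          (trans (eval-rename Φ (λ _ → fzero) (present c) (v ∷ᵛ y ∷ᵛ []ᵛ) (v ∷ᵛ []ᵛ) []ᵛ (λ { fzero → refl }))
                 (eval-exactlyOne Φ b (nodeF Tn c) (v ∷ᵛ []ᵛ) []ᵛ))) (allFin kn))) (allFin n))

    predecessor⇒≢0 : ∀ (q : Nout) → predecessorAt (proj₁ q) (copy q) ≡ true → ¬ toℕ (β q) ≡ 0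
    predecessor⇒≢0 q h q≡0 =
      let (v , h₁) = any-witness (allFin n) h
          (c , h₂) = any-witness (allFin kn) h₁
          p = (v , c , ∧-elimˡ h₂)
          e = trans (edge-pres isoO p fzero q) (∧-elimʳ {is-just (copyLabel Φ (nodeF Tn) v c)} h₂)
      in ℕ.0≢1+n (trans (sym q≡0) (ngr-edge⁻ z (β p) fzero (β q) e))

    ≢0⇒predecessor : ∀ (q : Nout) → ¬ toℕ (β q) ≡ 0 → predecessorAt (proj₁ q) (copy q) ≡ true
    ≢0⇒predecessor q q≢0 =
      let (j , q≡1+j) = toℕ≢0⇒predecessor (β q) q≢0
          p@(v , c , pr) = β⁻ j
          e : edgeRel (outputGraph Tn Φ) p fzero q ≡ true
          e = trans (sym (edge-pres isoO p fzero q))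
                    (ngr-edge⁺ z (β p) fzero (β q) (trans q≡1+j (cong (λ t → suc (toℕ t)) (sym (strictlyInverseˡ (bij isoO) j)))))
      in allFin-complete _ v (allFin-complete _ c (∧-intro pr e))

    egr-edge-from-root : ∀ (q : Nout) σ → edge (egr z) fzero σ (fsuc (β q)) ≡
                                          ⌊ lookup z (β q) F.≟ σ ⌋ ∧ not (predecessorAt (proj₁ q) (copy q))
    egr-edge-from-root q σ = ≡true-ext
      (λ e → let (q≡0 , σ≡) = egr-edge-0⁻ z σ (β q) e in
             ∧-intro (≟-true (sym σ≡)) (not-≡false (¬-not (λ h → predecessor⇒≢0 q h q≡0))))
      (λ e → egr-edge-0⁺ z σ (β q)
               (decidable-stable (toℕ (β q) ℕ.≟ 0) (λ q≢0 → true≢false (≢0⇒predecessor q q≢0) (not-≡true (∧-elimʳ {⌊ lookup z (β q) F.≟ σ ⌋} e))))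
               (sym (≟-sound (∧-elimˡ e))))

    egr-edge-between : ∀ (q q′ : Nout) σ → edge (egr z) (fsuc (β q)) σ (fsuc (β q′)) ≡
                                           edge (ngr z) (β q) fzero (β q′) ∧ ⌊ lookup z (β q′) F.≟ σ ⌋
    egr-edge-between q q′ σ = ≡true-ext
      (λ e → let (e₁ , σ≡) = egr-edge-suc⁻ z σ (β q) (β q′) e in ∧-intro (ngr-edge⁺ z (β q) fzero (β q′) e₁) (≟-true (sym σ≡)))
      (λ e → egr-edge-suc⁺ z σ (β q) (β q′) (ngr-edge⁻ z (β q) fzero (β q′) (∧-elimˡ e)) (sym (≟-sound (∧-elimʳ {edge (ngr z) (β q) fzero (β q′)} e))))

    output≃egr : outputOver G nodeFs edgeFs ≃ abstractGraph (egr z)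
    output≃egr = record { bij = Eout↔Fin ; lab-pres = λ _ → Fin1-irrelevant _ _ ; edge-pres = edges }
      where
        open ≡-Reasoning

        from-root : ∀ x c (pr : is-just (copyLabel G nodeFs x (inj₁ c)) ≡ true) σ x′ d (pr′ : is-just (copyLabel G nodeFs x′ (inj₂ d)) ≡ true) →
                    edge (egr z) fzero σ (fsuc (β (nodeOutput x′ d pr′))) ≡ eval G (edgeFs (inj₁ c) (inj₂ d) σ) (x ∷ᵛ x′ ∷ᵛ []ᵛ) []ᵛ
        from-root x c pr σ x′ d pr′ = sym (begin
          eval G (edgeFs (inj₁ c) (inj₂ d) σ) (x ∷ᵛ x′ ∷ᵛ []ᵛ) []ᵛ
            ≡⟨ cong₂ _∧_ x-is-root (eval-rename G (λ _ → fsuc fzero) (relativize (initial d σ)) (x ∷ᵛ x′ ∷ᵛ []ᵛ) (x′ ∷ᵛ []ᵛ) []ᵛ (λ { fzero → refl })) ⟩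
          eval G (relativize (initial d σ)) (x′ ∷ᵛ []ᵛ) []ᵛ
            ≡⟨ eval-relativize R (initial d σ) (x′ ∷ᵛ []ᵛ) []ᵛ (base x′ d pr′ ∷ᵛ []ᵛ) []ᵛ (λ { fzero → sym (punchIn-base x′ d pr′) }) (λ ()) ⟩
          eval Φ (initial d σ) (base x′ d pr′ ∷ᵛ []ᵛ) []ᵛ
            ≡⟨ eval-initial (nodeOutput x′ d pr′) σ ⟩
          ⌊ lookup z (β (nodeOutput x′ d pr′)) F.≟ σ ⌋ ∧ not (predecessorAt (base x′ d pr′) d)
            ≡⟨ sym (egr-edge-from-root (nodeOutput x′ d pr′) σ) ⟩
          edge (egr z) fzero σ (fsuc (β (nodeOutput x′ d pr′))) ∎)
          where
            x-is-root : eval G (negF (HasIncoming fzero)) (x ∷ᵛ x′ ∷ᵛ []ᵛ) []ᵛ ≡ true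
            x-is-root = trans (cong not (eval-HasIncoming fzero (x ∷ᵛ x′ ∷ᵛ []ᵛ) []ᵛ))
                              (trans (cong not (sym (eval-HasIncoming fzero (x ∷ᵛ []ᵛ) []ᵛ))) (trans (sym (copy-defined x (inj₁ c))) pr))

        between : ∀ x c (pr : is-just (copyLabel G nodeFs x (inj₂ c)) ≡ true) σ x′ d (pr′ : is-just (copyLabel G nodeFs x′ (inj₂ d)) ≡ true) →
                  edge (egr z) (fsuc (β (nodeOutput x c pr))) σ (fsuc (β (nodeOutput x′ d pr′))) ≡ eval G (edgeFs (inj₂ c) (inj₂ d) σ) (x ∷ᵛ x′ ∷ᵛ []ᵛ) []ᵛ
        between x c pr σ x′ d pr′ = sym (begin
          eval G (edgeFs (inj₂ c) (inj₂ d) σ) (x ∷ᵛ x′ ∷ᵛ []ᵛ) []ᵛ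
            ≡⟨ eval-relativize R (andF (edgeForm Tn c d fzero) (targetLabelled d σ)) (x ∷ᵛ x′ ∷ᵛ []ᵛ) []ᵛ (y ∷ᵛ y′ ∷ᵛ []ᵛ) []ᵛ
                               (λ { fzero → sym (punchIn-base x c pr) ; (fsuc fzero) → sym (punchIn-base x′ d pr′) }) (λ ()) ⟩
          edgeRel (outputGraph Tn Φ) q fzero q′ ∧ eval Φ (targetLabelled d σ) (y ∷ᵛ y′ ∷ᵛ []ᵛ) []ᵛ
            ≡⟨ cong₂ _∧_ (sym (edge-pres isoO q fzero q′))
                         (trans (eval-rename Φ (λ _ → fsuc fzero) (nodeF Tn d σ) (y ∷ᵛ y′ ∷ᵛ []ᵛ) (y′ ∷ᵛ []ᵛ) []ᵛ (λ { fzero → refl }))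
                                (eval-nodeF-output q′ σ)) ⟩
          edge (ngr z) (β q) fzero (β q′) ∧ ⌊ lookup z (β q′) F.≟ σ ⌋
            ≡⟨ sym (egr-edge-between q q′ σ) ⟩
          edge (egr z) (fsuc (β q)) σ (fsuc (β q′)) ∎)
          where
            q = nodeOutput x c pr
            q′ = nodeOutput x′ d pr′
            y = base x c pr
            y′ = base x′ d pr′

        edges : ∀ p σ p′ → edge (egr z) (toFin p) σ (toFin p′) ≡ edgeRel (outputOver G nodeFs edgeFs) p σ p′
        edges p σ p′@(x′ , inj₁ _ , _) = trans (egr-no-edge-into-0 z (toFin p) σ) (sym (into-root p))
          where
            into-root : ∀ p → edgeRel (outputOver G nodeFs edgeFs) p σ p′ ≡ false
            into-root (x , inj₁ _ , _) = eval-⊥F G (x ∷ᵛ x′ ∷ᵛ []ᵛ) []ᵛ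
            into-root (x , inj₂ _ , _) = eval-⊥F G (x ∷ᵛ x′ ∷ᵛ []ᵛ) []ᵛ
        edges (x , inj₁ c , pr) σ (x′ , inj₂ d , pr′) = from-root x c pr σ x′ d pr′
        edges (x , inj₂ c , pr) σ (x′ , inj₂ d , pr′) = between x c pr σ x′ d pr′

    edgeT-output : output edgeT G ≅ egr z
    edgeT-output = ≃⇒≅ (≃-trans (output≃outputGraph edgeT G) (≃-trans (outputOver-reindex G (FP.+↔⊎ {1} {kn}) nodeFs edgeFs) output≃egr))

MSOn⇒MSOe : ∀ {a b} (m : Transduction a b) → MSOn m → MSOe m
MSOn⇒MSOe {a} {b} m (Tn , Dn) = edgeT , defines
  where
    open Relativize {a}
    open EdgeTransducer Tn

    on-egr : ∀ {w z} → m w z → (eval (egr w) (dom edgeT) []ᵛ []ᵛ ≡ true) × (egr z ≅ output edgeT (egr w))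
    on-egr {w} {z} mwz = dom-true , ≅-sym (Output.edgeT-output (length w) (λ _ → fzero) (edge (egr w)) rooted-at {z} out≃z)
      where
        open OnEgr w
        Φ = OnGraph.nodeGraph (length w) (λ _ → fzero) (edge (egr w)) fzero L
        Φ-in-dom = proj₁ (Dn Φ (ngr z)) (w , z , mwz , nodeGraph≅ngr , ≅-refl)
        dom-true = ∧-intro egr-shape
          (trans (OnGraph.eval-relativize (length w) (λ _ → fzero) (edge (egr w)) rooted-at (dom Tn) []ᵛ []ᵛ []ᵛ []ᵛ (λ ()) (λ ())) (proj₁ Φ-in-dom))
        out≃z = ≃-trans (≃-sym (output≃outputGraph Tn Φ)) (≅⇒≃ (≅-sym (proj₂ Φ-in-dom)))

    Defines-at : Graph 1 a → Graph 1 b → Set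
    Defines-at g h = (egrRel m g h → (eval g (dom edgeT) []ᵛ []ᵛ ≡ true) × (h ≅ output edgeT g))
                   × ((eval g (dom edgeT) []ᵛ []ᵛ ≡ true) × (h ≅ output edgeT g) → egrRel m g h)

    -- The empty graph is not the edge graph of a string, and  uniqueSource  fails on it.
    defines-by-size : ∀ n lb ed h → Defines-at (record { size = n ; lab = lb ; edge = ed }) h
    defines-by-size zero lb ed h = (λ (_ , _ , _ , g≅w , _) → ⊥-elim (FP.¬Fin0 (from (_≅_.bij g≅w) fzero))) , λ { (() , _) }
    defines-by-size (suc n) lb ed h = sound , complete
      where
        open OnGraph n lb ed

        sound : egrRel m G h → (eval G (dom edgeT) []ᵛ []ᵛ ≡ true) × (h ≅ output edgeT G)
        sound (w , z , mwz , G≅w , h≅z) =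
          let (dom-true , z≅out) = on-egr mwz
          in trans (sentence-≅ G≅w (dom edgeT)) dom-true , ≅-trans h≅z (≅-trans z≅out (≅-sym (output-≅ edgeT G≅w)))

        from-shape : ∀ r → hasIncoming r ≡ false → (∀ x → hasIncoming x ≡ false → x ≡ r) → InDegree≤1 →
                     eval G (relativize (dom Tn)) []ᵛ []ᵛ ≡ true → h ≅ output edgeT G → egrRel m G h
        from-shape r r-source r-unique in≤1 relative-dom h≅out = w , z , mwz , G≅egr {w = w} Φ≅w , ≅-trans h≅out (Output.edgeT-output n lb ed rooted-at {z} out≃z)
          where
            open FromShape r r-source r-unique in≤1
            Φ = nodeGraph r L
            Φ-dom = trans (sym (eval-relativize rooted-at (dom Tn) []ᵛ []ᵛ []ᵛ []ᵛ (λ ()) (λ ()))) relative-dom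
            result = proj₂ (Dn Φ (output Tn Φ)) (Φ-dom , ≅-refl)
            w = proj₁ result
            z = proj₁ (proj₂ result)
            mwz = proj₁ (proj₂ (proj₂ result))
            Φ≅w = proj₁ (proj₂ (proj₂ (proj₂ result)))
            out≃z = ≃-trans (≃-sym (output≃outputGraph Tn Φ)) (≅⇒≃ (proj₂ (proj₂ (proj₂ (proj₂ result)))))

        complete : (eval G (dom edgeT) []ᵛ []ᵛ ≡ true) × (h ≅ output edgeT G) → egrRel m G h
        complete (dom-true , h≅out) =
          let shape = ∧-elimˡ dom-true
              (r , r-source , r-unique) = uniqueSource⁻ (∧-elimˡ shape)
          in from-shape r r-source r-unique (inDegree≤1⁻ (∧-elimʳ {eval G uniqueSource []ᵛ []ᵛ} shape))
                        (∧-elimʳ {eval G stringShape []ᵛ []ᵛ} dom-true) h≅out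

    defines : Defines edgeT (egrRel m)
    defines g = defines-by-size (size g) (lab g) (edge g)

MSOn⇒ε↦ε : ∀ {a b} (m : Transduction a b) → MSOn m → ∀ z → m [] z → z ≡ []
MSOn⇒ε↦ε m (Tn , Dn) z mεz = empty-output z (proj₂ (proj₁ (Dn (ngr []) (ngr z)) ([] , z , mεz , ≅-refl , ≅-refl)))
  where
    empty-output : ∀ z → ngr z ≅ output Tn (ngr []) → z ≡ []
    empty-output []      _   = refl
    empty-output (_ ∷ _) iso with () ← to (_≅_.bij iso) fzero

lemma3p9 : (a b : ℕ) (m : Transduction a b) →
    MSOn m ⇔ (MSOe m × (∀ z → m [] z → z ≡ []))
lemma3p9 a b m = mk⇔ (λ n → MSOn⇒MSOe m n , MSOn⇒ε↦ε m n) (λ (e , ε↦ε) → MSOe⇒MSOn m e ε↦ε)
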